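{- Let $P,Q$ be integers, $D=P^2-4Q$, and let $p$ be an odd prime with $p\nmid 2PQD$. Let $m$ be a positive divisor of $p-\left(\frac{D}{p}\right)$. Then the following are equivalent: (i) $m$ divides $s(p)$; (ii) there exists $X\in\mathbb{Z}$ such that $V_m(X,1)\equiv P^2Q^*-2 \pmod p$, where $Q^*$ denotes an integer with $QQ^*\equiv 1\pmod p$.
   Context: For integers $P,Q$, the Lucas sequences are defined by $U_0=0$, $U_1=1$, $U_{n+2}=PU_{n+1}-QU_n$ and $V_0=2$, $V_1=P$, $V_{n+2}=PV_{n+1}-QV_n$; these are integer sequences, and $V_n(X,1)$ is a polynomial in $X$ of degree $n$. $\left(\frac{\cdot}{p}\right)$ is the Legendre symbol. For $p\nmid Q$, the restricted period $r(p)$ is the least positive integer $r$ such that $p\mid U_r(P,Q)$; it is known that $r(p)$ divides $p-\left(\frac{D}{p}\right)$ when $p\nmid 2PQ$, and one sets $s(p)=\frac{p-(D/p)}{r(p)}$. -}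

module Defs where

open import Data.Nat as ℕ using (ℕ; zero; suc)
open import Data.Nat.DivMod using (_/_)
import Data.Nat.Divisibility as ℕD
open import Data.Integer as ℤ using (ℤ; +_; -[1+_]; _+_; _-_; _*_; -_; ∣_∣)
open import Data.Integer.Divisibility using (_∣_)
open import Data.List using (upTo)
open import Data.List.Relation.Unary.Any using (any?)
open import Relation.Nullary using (yes; no)

U : ℤ → ℤ → ℕ → ℤ
U P Q zero = + 0
U P Q (suc zero) = + 1
U P Q (suc (suc n)) = P * U P Q (suc n) - Q * U P Q n

V : ℤ → ℤ → ℕ → ℤ
V P Q zero = + 2
V P Q (suc zero) = P
V P Q (suc (suc n)) = P * V P Q (suc n) - Q * V P Q n

disc : ℤ → ℤ → ℤ
disc P Q = P * P - + 4 * Q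

_≡_[mod_] : ℤ → ℤ → ℕ → Set
a ≡ b [mod p ] = (+ p) ∣ (a - b)

legendre : ℤ → ℕ → ℤ
legendre a p with p ℕD.∣? ∣ a ∣
... | yes _ = + 0
... | no _ with any? (λ x → p ℕD.∣? ∣ (+ x) * (+ x) - a ∣) (upTo p)
...   | yes _ = + 1
...   | no _ = -[1+ 0 ]

-- p - (D/p) as a natural number (absolute value; positive whenever p is prime)
pMinusLeg : ℤ → ℤ → ℕ → ℕ
pMinusLeg P Q p = ∣ + p - legendre (disc P Q) p ∣

IsRestrictedPeriod : ℤ → ℤ → ℕ → ℕ → Set
IsRestrictedPeriod P Q p r =
  (0 ℕ.< r) × ((+ p) ∣ U P Q r) × (∀ k → 0 ℕ.< k → k ℕ.< r → ¬ ((+ p) ∣ U P Q k))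
  where
    open import Data.Product using (_×_)
    open import Relation.Nullary using (¬_)

sOf : ℤ → ℤ → ℕ → ℕ → ℕ
sOf P Q p zero = 0
sOf P Q p r@(suc _) = pMinusLeg P Q p / r

module Submission where

-- Let α, β be the roots of X² - P X + Q, adjoined to 𝔽ₚ as (P ± √D)/2; √D lies in 𝔽ₚ itself when D
-- is a square mod p and in the field 𝔽ₚ[√D] otherwise. Then γ = α/β = α² Q* lies in the group H of
-- elements of norm 1 (all of 𝔽ₚ* in the split case), which has order N = p - (D/p), and γᵏ = 1 iff
-- p ∣ Uₖ, so r(p) is the order of γ. Since a polynomial of degree n has at most n roots, γ is an m-th
-- power in H iff γ^(N/m) = 1, that is iff r ∣ N/m, that is iff m ∣ s(p). Finally, t ∈ H with tᵐ = γ
-- gives X = t + t⁻¹ with Vₘ(X,1) = tᵐ + t⁻ᵐ = γ + γ⁻¹ = P² Q* - 2. Conversely, from such an X,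
-- Vₘ² - (X² - 4) Uₘ² = 4 shows that X² - 4 is D times a square, so X = z + z⁻¹ for some z ∈ H,
-- and then zᵐ + z⁻ᵐ = γ + γ⁻¹ forces zᵐ = γ or z⁻ᵐ = γ.

open import Level using (0ℓ)
open import Algebra.Bundles using (CommutativeRing; Semiring)
open import Algebra.Core using (Op₁; Op₂)
import Algebra.Definitions as AlgebraDefinitions
open import Algebra.Solver.Ring.AlmostCommutativeRing using (_-Raw-AlmostCommutative⟶_; fromCommutativeRing)
open import Algebra.Structures using (IsCommutativeRing)
open import Data.Empty using (⊥)
open import Data.Integer as ℤ using (ℤ; +_; -[1+_])
import Data.Integer.DivMod as ℤ
import Data.Integer.Divisibility as ℤᵤ
import Data.Integer.Divisibility.Signed as ℤₛ
import Data.Integer.Properties as ℤ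
open import Data.Integer.Tactic.RingSolver using (solve-∀)
open import Data.List using (List; []; _∷_; length; map; filter; foldr; applyUpTo; upTo)
import Data.List.Membership.Propositional as Membership
open import Data.List.Membership.Propositional.Properties using (∈-upTo⁺)
open import Data.List.Membership.Setoid.Properties using (∈-resp-≈)
import Data.List.Properties as List
open import Data.List.Relation.Unary.All as All using (All; []; _∷_)
import Data.List.Relation.Unary.All.Properties as All
open import Data.List.Relation.Unary.AllPairs using ([]; _∷_)
import Data.List.Relation.Unary.AllPairs.Properties as AllPairs
open import Data.List.Relation.Unary.Any as Any using (Any; here; there; any?; _─_)
import Data.List.Relation.Unary.Any.Properties as Any
import Data.Maybe as Maybe
open import Data.Nat as ℕ using (ℕ; zero; suc; z≤n; s≤s)
import Data.Nat.Divisibility as ℕ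
open import Data.Nat.DivMod using (_%_; _/_; m≡m%n+[m/n]*n; m%n<n)
open import Data.Nat.Primality using (Prime; euclidsLemma; prime⇒nonZero; prime⇒nonTrivial)
import Data.Nat.Properties as ℕ
open import Data.Product using (∃; ∃₂; ∃-syntax; _×_; _,_; proj₁; proj₂)
open import Data.Product.Relation.Binary.Pointwise.NonDependent using (Pointwise; ×-isEquivalence; ×-decidable)
open import Data.Sum using (_⊎_; [_,_]′)
import Data.Sum as Sum
open import Function.Base using (_∘_; id; case_of_)
open import Function.Bundles using (_⇔_; mk⇔; module Equivalence)
import Function.Properties.Equivalence as ⇔
open import Relation.Binary.Bundles using (DecSetoid)
open import Relation.Binary.Core using (Rel)
open import Relation.Binary.Definitions using (Decidable)
open import Relation.Binary.PropositionalEquality as ≡ using (_≡_; _≢_)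
open import Relation.Binary.Structures using (IsEquivalence)
open import Relation.Nullary using (¬_; Dec; yes; no; ¬?)
import Relation.Nullary.Decidable as Dec
open import Relation.Nullary.Decidable using (dec⇒maybe)
open import Relation.Nullary.Negation using (contradiction)

open import Defs

module QuotientRing
  {A : Set} {_+ᴬ_ _*ᴬ_ : Op₂ A} { -ᴬ_ : Op₁ A } {0ᴬ 1ᴬ : A}
  (isCommutativeRing : IsCommutativeRing _≡_ _+ᴬ_ _*ᴬ_ -ᴬ_ 0ᴬ 1ᴬ)
  {_∼_ : Rel A 0ℓ} (isEquivalence : IsEquivalence _∼_)
  (+-cong : AlgebraDefinitions.Congruent₂ _∼_ _+ᴬ_)
  (*-cong : AlgebraDefinitions.Congruent₂ _∼_ _*ᴬ_)
  (-‿cong : AlgebraDefinitions.Congruent₁ _∼_ -ᴬ_)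
  where

  private
    module ≡-Ring = IsCommutativeRing isCommutativeRing
    ∼-reflexive : ∀ {x y} → x ≡ y → x ∼ y
    ∼-reflexive ≡.refl = IsEquivalence.refl isEquivalence

  commutativeRing : CommutativeRing 0ℓ 0ℓ
  commutativeRing = record
    { Carrier = A ; _≈_ = _∼_ ; _+_ = _+ᴬ_ ; _*_ = _*ᴬ_ ; -_ = -ᴬ_ ; 0# = 0ᴬ ; 1# = 1ᴬ
    ; isCommutativeRing = record
      { isRing = record
        { +-isAbelianGroup = record
          { isGroup = record
            { isMonoid = record
              { isSemigroup = record
                { isMagma = record { isEquivalence = isEquivalence ; ∙-cong = +-cong }
                ; assoc = λ x y z → ∼-reflexive (≡-Ring.+-assoc x y z) }
              ; identity = (∼-reflexive ∘ ≡-Ring.+-identityˡ) , (∼-reflexive ∘ ≡-Ring.+-identityʳ) }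
            ; inverse = (∼-reflexive ∘ ≡-Ring.-‿inverseˡ) , (∼-reflexive ∘ ≡-Ring.-‿inverseʳ)
            ; ⁻¹-cong = -‿cong }
          ; comm = λ x y → ∼-reflexive (≡-Ring.+-comm x y) }
        ; *-cong = *-cong
        ; *-assoc = λ x y z → ∼-reflexive (≡-Ring.*-assoc x y z)
        ; *-identity = (∼-reflexive ∘ ≡-Ring.*-identityˡ) , (∼-reflexive ∘ ≡-Ring.*-identityʳ)
        ; distrib = (λ x y z → ∼-reflexive (≡-Ring.distribˡ x y z))
                  , (λ x y z → ∼-reflexive (≡-Ring.distribʳ x y z)) }
      ; *-comm = λ x y → ∼-reflexive (≡-Ring.*-comm x y) } }

module SemiringPowers (S : Semiring 0ℓ 0ℓ) where

  open Semiring S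
  open import Algebra.Properties.Semiring.Exp S

  1^n≈1 : ∀ n → 1# ^ n ≈ 1#
  1^n≈1 zero    = refl
  1^n≈1 (suc n) = trans (*-identityˡ _) (1^n≈1 n)

  ^-multiple≈1 : ∀ {x r} q → x ^ r ≈ 1# → x ^ (q ℕ.* r) ≈ 1#
  ^-multiple≈1 {x} {r} q xʳ≈1 = begin
    x ^ (q ℕ.* r) ≡⟨ ≡.cong (x ^_) (ℕ.*-comm q r) ⟩
    x ^ (r ℕ.* q) ≈⟨ ^-assocʳ x r q ⟨
    (x ^ r) ^ q   ≈⟨ ^-congˡ q xʳ≈1 ⟩
    1# ^ q        ≈⟨ 1^n≈1 q ⟩
    1#            ∎
    where open import Relation.Binary.Reasoning.Setoid setoid

  ^≈1⇔order∣ : ∀ {x r} → 0 ℕ.< r → x ^ r ≈ 1# → (∀ t → 0 ℕ.< t → t ℕ.< r → ¬ x ^ t ≈ 1#) →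
               ∀ k → x ^ k ≈ 1# ⇔ r ℕ.∣ k
  ^≈1⇔order∣ {x} {r@(suc _)} _ xʳ≈1 minimal k = mk⇔ to from
    where
    from : r ℕ.∣ k → x ^ k ≈ 1#
    from (ℕ.divides q ≡.refl) = ^-multiple≈1 q xʳ≈1

    x^k≈x^[k%r] : x ^ k ≈ x ^ (k % r)
    x^k≈x^[k%r] = begin
      x ^ k                                ≡⟨ ≡.cong (x ^_) (m≡m%n+[m/n]*n k r) ⟩
      x ^ (k % r ℕ.+ (k / r) ℕ.* r)        ≈⟨ ^-homo-* x (k % r) _ ⟩
      x ^ (k % r) * x ^ ((k / r) ℕ.* r)    ≈⟨ *-congˡ (^-multiple≈1 (k / r) xʳ≈1) ⟩
      x ^ (k % r) * 1#                     ≈⟨ *-identityʳ _ ⟩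
      x ^ (k % r)                          ∎
      where open import Relation.Binary.Reasoning.Setoid setoid

    to : x ^ k ≈ 1# → r ℕ.∣ k
    to xᵏ≈1 with k % r in k%r≡ | m%n<n k r
    ... | zero  | _   = ℕ.m%n≡0⇒n∣m k r k%r≡
    ... | suc t | t<r = contradiction (trans (sym x^k≈x^[1+t]) xᵏ≈1) (minimal (suc t) (s≤s z≤n) t<r)
      where
      x^k≈x^[1+t] : x ^ k ≈ x ^ suc t
      x^k≈x^[1+t] = trans x^k≈x^[k%r] (reflexive (≡.cong (x ^_) k%r≡))

module FibreCounting (S : DecSetoid 0ℓ 0ℓ) where

  open DecSetoid S
  open import Data.List.Membership.Setoid setoid using (_∈_)
  open import Data.List.Relation.Unary.Unique.Setoid setoid using (Unique)
  import Data.List.Relation.Unary.Unique.Setoid.Properties as Unique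

  length-filter-∁ : ∀ {P : Carrier → Set} (P? : ∀ x → Dec (P x)) xs →
                    length (filter P? xs) ℕ.+ length (filter (¬? ∘ P?) xs) ≡ length xs
  length-filter-∁ P? []       = ≡.refl
  length-filter-∁ P? (x ∷ xs) with P? x
  ... | yes _ = ≡.cong suc (length-filter-∁ P? xs)
  ... | no  _ = ≡.trans (ℕ.+-suc _ _) (≡.cong suc (length-filter-∁ P? xs))

  fibres-bound : (φ : Carrier → Carrier) (m : ℕ) →
                 (∀ w {ys} → Unique ys → All (λ y → φ y ≈ w) ys → length ys ℕ.≤ m) →
                 ∀ L {xs} → Unique xs → All (λ x → φ x ∈ L) xs → length xs ℕ.≤ m ℕ.* length L
  fibres-bound φ m fibre-bound []      {[]}    _ _           = z≤n
  fibres-bound φ m fibre-bound []      {_ ∷ _} _ (() ∷ _)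
  fibres-bound φ m fibre-bound (w ∷ L) {xs}    xs! φxs∈w∷L = begin
    length xs                                      ≡⟨ length-filter-∁ (λ x → φ x ≟ w) xs ⟨
    length (filter _ xs) ℕ.+ length (filter _ xs)  ≤⟨ ℕ.+-mono-≤ in-fibre outside-fibre ⟩
    m ℕ.+ m ℕ.* length L                           ≡⟨ ℕ.*-suc m (length L) ⟨
    m ℕ.* length (w ∷ L)                           ∎
    where
    open ℕ.≤-Reasoning
    in-fibre : length (filter (λ x → φ x ≟ w) xs) ℕ.≤ m
    in-fibre = fibre-bound w (Unique.filter⁺ setoid (λ x → φ x ≟ w) xs!)
                 (All.all-filter (λ x → φ x ≟ w) xs)
    outside-fibre : length (filter (λ x → ¬? (φ x ≟ w)) xs) ℕ.≤ m ℕ.* length L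
    outside-fibre = fibres-bound φ m fibre-bound L (Unique.filter⁺ setoid (λ x → ¬? (φ x ≟ w)) xs!)
      (All.zipWith into-L (All.all-filter (λ x → ¬? (φ x ≟ w)) xs , All.filter⁺ (λ x → ¬? (φ x ≟ w)) φxs∈w∷L))
      where
      into-L : ∀ {x} → ¬ φ x ≈ w × φ x ∈ w ∷ L → φ x ∈ L
      into-L (φx≉w , here φx≈w) = contradiction φx≈w φx≉w
      into-L (_    , there φx∈L) = φx∈L

module _ (R : CommutativeRing 0ℓ 0ℓ) where

  open CommutativeRing R

  Nontrivial : Set
  Nontrivial = ¬ 1# ≈ 0#

  NoZeroDivisors : Set
  NoZeroDivisors = ∀ x y → x * y ≈ 0# → x ≈ 0# ⊎ y ≈ 0#

-- ι is only used to give the ring solver integer coefficients.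
module IntegralDomain
  (R : CommutativeRing 0ℓ 0ℓ)
  (ι-morphism : ℤ.+-*-rawRing -Raw-AlmostCommutative⟶ fromCommutativeRing R)
  (_≟_ : Decidable (CommutativeRing._≈_ R))
  (1≉0 : Nontrivial R)
  (zero-divisor : NoZeroDivisors R)
  where

  open CommutativeRing R
  open _-Raw-AlmostCommutative⟶_ ι-morphism public
    renaming (⟦_⟧ to ι; +-homo to ι-+; *-homo to ι-*; -‿homo to ι--; 0-homo to ι-0; 1-homo to ι-1)
  open import Algebra.Properties.Ring ring using (x∙y⁻¹≈ε⇒x≈y; [y-z]x≈yx-zx)
  open import Algebra.Properties.CommutativeSemigroup *-commutativeSemigroup using (x∙yz≈y∙xz)
  open import Algebra.Properties.CommutativeSemiring.Exp commutativeSemiring public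
  open import Algebra.Solver.Ring ℤ.+-*-rawRing (fromCommutativeRing R) ι-morphism
    (λ a b → Maybe.map (reflexive ∘ ≡.cong ι) (dec⇒maybe (a ℤ.≟ b))) public
    using (solve; _:=_; _:+_; _:-_; _:*_; :-_; con)
  open import Relation.Binary.Reasoning.Setoid setoid
  open import Data.List.Membership.Setoid setoid public using (_∈_)
  open import Data.List.Membership.Setoid setoid using (find)
  open import Data.List.Membership.Setoid.Properties using (∈-filter⁺)
  open import Data.List.Relation.Unary.Unique.Setoid setoid public using (Unique)
  import Data.List.Relation.Unary.Unique.Setoid.Properties as Unique
  open SemiringPowers semiring public

  decSetoid : DecSetoid 0ℓ 0ℓ
  decSetoid = record { isDecEquivalence = record { isEquivalence = isEquivalence ; _≟_ = _≟_ } }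

  open FibreCounting decSetoid using (fibres-bound)

  *-cancelʳ-⊎ : ∀ {x y z} → x * z ≈ y * z → x ≈ y ⊎ z ≈ 0#
  *-cancelʳ-⊎ {x} {y} {z} xz≈yz = Sum.map₁ (x∙y⁻¹≈ε⇒x≈y x y) (zero-divisor (x - y) z (begin
    (x - y) * z    ≈⟨ [y-z]x≈yx-zx z x y ⟩
    x * z - y * z  ≈⟨ +-congʳ xz≈yz ⟩
    y * z - y * z  ≈⟨ -‿inverseʳ (y * z) ⟩
    0#             ∎))

  *-cancelʳ : ∀ {x y z} → ¬ z ≈ 0# → x * z ≈ y * z → x ≈ y
  *-cancelʳ z≉0 xz≈yz = [ id , (λ z≈0 → contradiction z≈0 z≉0) ]′ (*-cancelʳ-⊎ xz≈yz)

  unit≉0 : ∀ {x y} → x * y ≈ 1# → ¬ x ≈ 0#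
  unit≉0 {x} {y} xy≈1 x≈0 = 1≉0 (begin
    1#      ≈⟨ xy≈1 ⟨
    x * y   ≈⟨ *-congʳ x≈0 ⟩
    0# * y  ≈⟨ zeroˡ y ⟩
    0#      ∎)

  inverse-unique : ∀ {x y z} → x * y ≈ 1# → x * z ≈ 1# → y ≈ z
  inverse-unique {x} {y} {z} xy≈1 xz≈1 = *-cancelʳ (unit≉0 xy≈1) (begin
    y * x  ≈⟨ *-comm y x ⟩
    x * y  ≈⟨ trans xy≈1 (sym xz≈1) ⟩
    x * z  ≈⟨ *-comm x z ⟩
    z * x  ∎)

  sum-product-determine : ∀ {a a′ g g′} → a + a′ ≈ g + g′ → a * a′ ≈ g * g′ → a ≈ g ⊎ a ≈ g′
  sum-product-determine {a} {a′} {g} {g′} sum≈ product≈ =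
    Sum.map (x∙y⁻¹≈ε⇒x≈y a g) (x∙y⁻¹≈ε⇒x≈y a g′) (zero-divisor (a - g) (a - g′) (begin
      (a - g) * (a - g′)              ≈⟨ solve 3 (λ a g g′ → (a :- g) :* (a :- g′) := a :* a :- a :* (g :+ g′) :+ g :* g′) refl a g g′ ⟩
      a * a - a * (g + g′) + g * g′   ≈⟨ +-cong (+-congˡ (-‿cong (*-congˡ (sym sum≈)))) (sym product≈) ⟩
      a * a - a * (a + a′) + a * a′   ≈⟨ solve 2 (λ a a′ → a :* a :- a :* (a :+ a′) :+ a :* a′ := con (ℤ.+ 0)) refl a a′ ⟩
      ι (ℤ.+ 0)                       ≈⟨ ι-0 ⟩
      0#                              ∎))

  eval : List Carrier → Carrier → Carrier
  eval []      x = 0#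
  eval (a ∷ f) x = a + x * eval f x

  LeadingCoefficient≉0 : List Carrier → Set
  LeadingCoefficient≉0 []          = ⊥
  LeadingCoefficient≉0 (a ∷ [])    = ¬ a ≈ 0#
  LeadingCoefficient≉0 (_ ∷ b ∷ f) = LeadingCoefficient≉0 (b ∷ f)

  -- The quotient of f by X - r: its coefficient of Xᵏ is the value at r of the tail f_{k+1} + f_{k+2} X + ⋯.
  quotient : Carrier → List Carrier → List Carrier
  quotient r []          = []
  quotient r (_ ∷ [])    = []
  quotient r (_ ∷ b ∷ f) = eval (b ∷ f) r ∷ quotient r (b ∷ f)

  eval-[] : ∀ a x → eval (a ∷ []) x ≈ a
  eval-[] a x = trans (+-congˡ (zeroʳ x)) (+-identityʳ a)

  -- f(x) - f(r) = (x - r) q(x), with both sides rearranged to avoid subtraction.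
  eval-quotient : ∀ r f x → eval f x + r * eval (quotient r f) x ≈ eval f r + x * eval (quotient r f) x
  eval-quotient r []          x = +-congˡ (trans (zeroʳ r) (sym (zeroʳ x)))
  eval-quotient r (a ∷ [])    x = +-cong (trans (eval-[] a x) (sym (eval-[] a r))) (trans (zeroʳ r) (sym (zeroʳ x)))
  eval-quotient r (a ∷ b ∷ f) x = begin
    (a + x * g) + r * (gᵣ + x * q)  ≈⟨ solve 6 (λ a x g r gᵣ q → (a :+ x :* g) :+ r :* (gᵣ :+ x :* q) := (a :+ r :* gᵣ) :+ x :* (g :+ r :* q)) refl a x g r gᵣ q ⟩
    (a + r * gᵣ) + x * (g + r * q)  ≈⟨ +-congˡ (*-congˡ (eval-quotient r (b ∷ f) x)) ⟩
    (a + r * gᵣ) + x * (gᵣ + x * q) ∎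
    where
    g  = eval (b ∷ f) x
    gᵣ = eval (b ∷ f) r
    q  = eval (quotient r (b ∷ f)) x

  length-quotient : ∀ r a f → length (quotient r (a ∷ f)) ≡ length f
  length-quotient r a []      = ≡.refl
  length-quotient r a (b ∷ f) = ≡.cong suc (length-quotient r b f)

  quotient-leading : ∀ r a b f → LeadingCoefficient≉0 (a ∷ b ∷ f) →
                     LeadingCoefficient≉0 (quotient r (a ∷ b ∷ f))
  quotient-leading r a b []      b≉0 = b≉0 ∘ trans (sym (eval-[] b r))
  quotient-leading r a b (c ∷ f) lc  = quotient-leading r b c f lc

  roots-bound : ∀ f {rs} → LeadingCoefficient≉0 f → Unique rs → All (λ r → eval f r ≈ 0#) rs →
                length rs ℕ.< length f
  roots-bound (a ∷ f)     {[]}     _   _ _ = s≤s z≤n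
  roots-bound (a ∷ [])    {r ∷ _}  a≉0 _ (ar≈0 ∷ _) = contradiction (trans (sym (eval-[] a r)) ar≈0) a≉0
  roots-bound (a ∷ b ∷ f) {r ∷ rs} lc (r∉rs ∷ rs!) (fr≈0 ∷ frs≈0) =
    s≤s (≡.subst (length rs ℕ.<_) (length-quotient r a (b ∷ f))
      (roots-bound (quotient r (a ∷ b ∷ f)) (quotient-leading r a b f lc) rs!
        (All.zipWith root-of-quotient (r∉rs , frs≈0))))
    where
    root-of-quotient : ∀ {t} → ¬ r ≈ t × eval (a ∷ b ∷ f) t ≈ 0# → eval (quotient r (a ∷ b ∷ f)) t ≈ 0#
    root-of-quotient {t} (r≉t , ft≈0) = [ (λ r≈t → contradiction r≈t r≉t) , id ]′ (*-cancelʳ-⊎ (begin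
      r * q                     ≈⟨ +-identityˡ _ ⟨
      0# + r * q                ≈⟨ +-congʳ ft≈0 ⟨
      eval (a ∷ b ∷ f) t + r * q ≈⟨ eval-quotient r (a ∷ b ∷ f) t ⟩
      eval (a ∷ b ∷ f) r + t * q ≈⟨ +-congʳ fr≈0 ⟩
      0# + t * q                ≈⟨ +-identityˡ _ ⟩
      t * q                     ∎))
      where q = eval (quotient r (a ∷ b ∷ f)) t

  monomial : ℕ → List Carrier
  monomial zero    = 1# ∷ []
  monomial (suc n) = 0# ∷ monomial n

  eval-monomial : ∀ n x → eval (monomial n) x ≈ x ^ n
  eval-monomial zero    x = eval-[] 1# x
  eval-monomial (suc n) x = trans (+-identityˡ _) (*-congˡ (eval-monomial n x))

  monomial-leading : ∀ a n → LeadingCoefficient≉0 (a ∷ monomial n)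
  monomial-leading a zero    = 1≉0
  monomial-leading a (suc n) = monomial-leading 0# n

  length-monomial : ∀ n → length (monomial n) ≡ suc n
  length-monomial zero    = ≡.refl
  length-monomial (suc n) = ≡.cong suc (length-monomial n)

  ^-roots-bound : ∀ {m y ts} → 0 ℕ.< m → Unique ts → All (λ t → t ^ m ≈ y) ts → length ts ℕ.≤ m
  ^-roots-bound {suc k} {y} {ts} _ ts! tsᵐ≈y = ℕ.≤-pred
    (≡.subst (length ts ℕ.<_) (≡.cong suc (length-monomial k))
      (roots-bound ((- y) ∷ monomial k) (monomial-leading (- y) k) ts! (All.map root tsᵐ≈y)))
    where
    root : ∀ {t} → t ^ suc k ≈ y → eval ((- y) ∷ monomial k) t ≈ 0#
    root {t} tᵐ≈y = begin
      - y + t * eval (monomial k) t ≈⟨ +-congˡ (*-congˡ (eval-monomial k t)) ⟩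
      - y + t ^ suc k               ≈⟨ +-congˡ tᵐ≈y ⟩
      - y + y                       ≈⟨ -‿inverseˡ y ⟩
      0#                            ∎

  ^≉0 : ∀ {x} n → ¬ x ≈ 0# → ¬ x ^ n ≈ 0#
  ^≉0 zero    _   = 1≉0
  ^≉0 (suc n) x≉0 = [ x≉0 , ^≉0 n x≉0 ]′ ∘ zero-divisor _ _

  ^-unit : ∀ {z w} n → z * w ≈ 1# → z ^ n * w ^ n ≈ 1#
  ^-unit {z} {w} n zw≈1 = trans (sym (^-distrib-* z w n)) (trans (^-congˡ n zw≈1) (1^n≈1 n))

  *-cancelˡ : ∀ {x y z} → ¬ z ≈ 0# → z * x ≈ z * y → x ≈ y
  *-cancelˡ {x} {y} {z} z≉0 zx≈zy = *-cancelʳ z≉0 (trans (*-comm x z) (trans zx≈zy (*-comm z y)))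

  module FiniteSubgroup
    (H : List Carrier) (H! : Unique H)
    (∈H-closed : ∀ {a b} → a ∈ H → b ∈ H → a * b ∈ H)
    (1∈H : 1# ∈ H)
    (∈H⇒≉0 : ∀ {a} → a ∈ H → ¬ a ≈ 0#)
    where

    order : ℕ
    order = length H

    product : List Carrier → Carrier
    product = foldr _*_ 1#

    product≉0 : ∀ xs → All (λ x → ¬ x ≈ 0#) xs → ¬ product xs ≈ 0#
    product≉0 []       []            = 1≉0
    product≉0 (x ∷ xs) (x≉0 ∷ xs≉0) x*xs≈0 = [ x≉0 , product≉0 xs xs≉0 ]′ (zero-divisor x (product xs) x*xs≈0)

    product-─ : ∀ {x} ys (x∈ys : x ∈ ys) → product ys ≈ x * product (ys ─ x∈ys)
    product-─ (y ∷ ys) (here x≈y)   = *-congʳ (sym x≈y)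
    product-─ (y ∷ ys) (there x∈ys) = trans (*-congˡ (product-─ ys x∈ys)) (x∙yz≈y∙xz y _ _)

    ∈-─⁺ : ∀ {x z} ys (x∈ys : x ∈ ys) → z ∈ ys → ¬ x ≈ z → z ∈ (ys ─ x∈ys)
    ∈-─⁺ (y ∷ ys) (here x≈y)   (here z≈y)   x≉z = contradiction (trans x≈y (sym z≈y)) x≉z
    ∈-─⁺ (y ∷ ys) (here _)     (there z∈ys) _   = z∈ys
    ∈-─⁺ (y ∷ ys) (there _)    (here z≈y)   _   = here z≈y
    ∈-─⁺ (y ∷ ys) (there x∈ys) (there z∈ys) x≉z = there (∈-─⁺ ys x∈ys z∈ys x≉z)

    unique-⊆⇒product≈ : ∀ xs ys → Unique xs → All (_∈ ys) xs → length xs ≡ length ys →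
                        product xs ≈ product ys
    unique-⊆⇒product≈ []       []      _             _               _  = refl
    unique-⊆⇒product≈ []       (_ ∷ _) _             _               ()
    unique-⊆⇒product≈ (x ∷ xs) ys      (x∉xs ∷ xs!) (x∈ys ∷ xs⊆ys) |xs|≡|ys| = begin
      x * product xs           ≈⟨ *-congˡ (unique-⊆⇒product≈ xs (ys ─ x∈ys) xs! xs⊆ys─x
                                    (ℕ.suc-injective (≡.trans |xs|≡|ys| (List.length-removeAt′ ys _)))) ⟩
      x * product (ys ─ x∈ys)  ≈⟨ product-─ ys x∈ys ⟨
      product ys               ∎
      where
      xs⊆ys─x = All.zipWith (λ (x≉z , z∈ys) → ∈-─⁺ ys x∈ys z∈ys x≉z) (x∉xs , xs⊆ys)

    product-map-* : ∀ z xs → product (map (z *_) xs) ≈ z ^ length xs * product xs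
    product-map-* z []       = sym (*-identityˡ 1#)
    product-map-* z (x ∷ xs) = begin
      z * x * product (map (z *_) xs)       ≈⟨ *-congˡ (product-map-* z xs) ⟩
      z * x * (z ^ length xs * product xs)  ≈⟨ solve 4 (λ z x a b → z :* x :* (a :* b) := z :* a :* (x :* b)) refl z x _ _ ⟩
      z * z ^ length xs * (x * product xs)  ∎

    H⊆H : All (_∈ H) H
    H⊆H = All.tabulateₛ setoid id

    lagrange : ∀ {z} → z ∈ H → z ^ order ≈ 1#
    lagrange {z} z∈H = *-cancelʳ (product≉0 H (All.map ∈H⇒≉0 H⊆H)) (begin
      z ^ order * product H   ≈⟨ product-map-* z H ⟨
      product (map (z *_) H)  ≈⟨ unique-⊆⇒product≈ (map (z *_) H) H zH! zH⊆H (List.length-map _ H) ⟩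
      product H               ≈⟨ *-identityˡ _ ⟨
      1# * product H          ∎)
      where
      zH! = Unique.map⁺ setoid setoid (*-cancelˡ (∈H⇒≉0 z∈H)) H!
      zH⊆H = All.map⁺ (All.map (∈H-closed z∈H) H⊆H)

    ^-∈H : ∀ {z} n → z ∈ H → z ^ n ∈ H
    ^-∈H zero    _   = 1∈H
    ^-∈H (suc n) z∈H = ∈H-closed z∈H (^-∈H n z∈H)

    0<order : 0 ℕ.< order
    0<order = nonempty 1∈H
      where
      nonempty : ∀ {x xs} → x ∈ xs → 0 ℕ.< length xs
      nonempty (here _)  = s≤s z≤n
      nonempty (there _) = s≤s z≤n

    ∈H⇒invertible : ∀ {z} → z ∈ H → ∃[ w ] w ∈ H × z * w ≈ 1#
    ∈H⇒invertible {z} z∈H = z ^ ℕ.pred order , ^-∈H (ℕ.pred order) z∈H ,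
      ≡.subst (λ n → z ^ n ≈ 1#) (≡.sym (ℕ.suc-pred order ⦃ ℕ.>-nonZero 0<order ⦄)) (lagrange z∈H)

    mth-power⇒^M≈1 : ∀ {m M t} → m ℕ.* M ≡ order → t ∈ H → (t ^ m) ^ M ≈ 1#
    mth-power⇒^M≈1 {m} {M} {t} mM≡order t∈H = begin
      (t ^ m) ^ M    ≈⟨ ^-assocʳ t m M ⟩
      t ^ (m ℕ.* M)  ≡⟨ ≡.cong (t ^_) mM≡order ⟩
      t ^ order      ≈⟨ lagrange t∈H ⟩
      1#             ∎

    module OtherRoots (M : ℕ) (y : Carrier) where

      OtherRoot : Carrier → Set
      OtherRoot w = w ^ M ≈ 1# × ¬ w ≈ y

      other-root? : ∀ w → Dec (OtherRoot w)
      other-root? w with (w ^ M) ≟ 1# | w ≟ y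
      ... | yes wᴹ≈1 | no w≉y  = yes (wᴹ≈1 , w≉y)
      ... | yes _    | yes w≈y = no (λ (_ , w≉y) → w≉y w≈y)
      ... | no wᴹ≉1  | _       = no (λ (wᴹ≈1 , _) → wᴹ≉1 wᴹ≈1)

      other-root-resp : ∀ {v w} → v ≈ w → OtherRoot v → OtherRoot w
      other-root-resp v≈w (vᴹ≈1 , v≉y) = trans (^-congˡ M (sym v≈w)) vᴹ≈1 , λ w≈y → v≉y (trans v≈w w≈y)

      other-roots : List Carrier
      other-roots = filter other-root? H

      ∈-other-roots : ∀ {w} → w ∈ H → OtherRoot w → w ∈ other-roots
      ∈-other-roots = ∈-filter⁺ setoid other-root? other-root-resp

      length-other-roots : 0 ℕ.< M → y ^ M ≈ 1# → length other-roots ℕ.< M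
      length-other-roots 0<M yᴹ≈1 = ^-roots-bound 0<M y∷other-roots! (yᴹ≈1 ∷ All.map proj₁ (All.all-filter other-root? H))
        where
        y∷other-roots! : Unique (y ∷ other-roots)
        y∷other-roots! = All.map (λ (_ , w≉y) y≈w → w≉y (sym y≈w)) (All.all-filter other-root? H)
                       ∷ Unique.filter⁺ setoid other-root? H!

    -- Otherwise the m-th power map sends H into the M-th roots of unity other than y; as its fibres
    -- and the roots of unity are bounded by m and M, this gives order ≤ m (M - 1).
    ^M≈1⇒mth-power : ∀ {m M y} → 0 ℕ.< m → m ℕ.* M ≡ order → y ∈ H → y ^ M ≈ 1# →
                     ∃[ t ] t ∈ H × t ^ m ≈ y
    ^M≈1⇒mth-power {m} {M} {y} 0<m mM≡order y∈H yᴹ≈1 with any? (λ t → (t ^ m) ≟ y) H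
    ... | yes found = find found
    ... | no ¬found = contradiction (ℕ.≤-<-trans order≤m*others m*others<order) (ℕ.<-irrefl ≡.refl)
      where
      open OtherRoots M y

      power-is-other : ∀ {t} → t ∈ H → t ^ m ∈ other-roots
      power-is-other {t} t∈H = ∈-other-roots (^-∈H m t∈H) (mth-power⇒^M≈1 {m} {M} mM≡order t∈H ,
        λ tᵐ≈y → ¬found (Any.map (λ t≈h → trans (^-congˡ m (sym t≈h)) tᵐ≈y) t∈H))

      order≤m*others : order ℕ.≤ m ℕ.* length other-roots
      order≤m*others = fibres-bound (_^ m) m (λ w → ^-roots-bound 0<m) other-roots H! (All.map power-is-other H⊆H)

      0<M : 0 ℕ.< M
      0<M = ℕ.n≢0⇒n>0 λ { ≡.refl → ℕ.<-irrefl (≡.trans (≡.sym (ℕ.*-zeroʳ m)) mM≡order) 0<order }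

      m*others<order : m ℕ.* length other-roots ℕ.< order
      m*others<order = ≡.subst (m ℕ.* length other-roots ℕ.<_) mM≡order
        (ℕ.*-monoʳ-< m ⦃ ℕ.>-nonZero 0<m ⦄ (length-other-roots 0<M yᴹ≈1))

module Modular (p : ℕ) (p-prime : Prime p) where

  open import Data.Integer.Base using (_+_; _-_; _*_; -_)

  private
    instance
      p≢0 : ℕ.NonZero p
      p≢0 = prime⇒nonZero p-prime

  -- A record rather than a synonym of _≡_[mod p ], so that both sides can be inferred from a proof.
  infix 4 _≈ₚ_
  record _≈ₚ_ (a b : ℤ) : Set where
    constructor mod
    field unmod : a ≡ b [mod p ]
  open _≈ₚ_ public

  ∣⇒≈ₚ : ∀ {a b} → + p ℤₛ.∣ a - b → a ≈ₚ b
  ∣⇒≈ₚ = mod ∘ ℤₛ.∣⇒∣ᵤ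

  ≈ₚ⇒∣ : ∀ {a b} → a ≈ₚ b → + p ℤₛ.∣ a - b
  ≈ₚ⇒∣ = ℤₛ.∣ᵤ⇒∣ ∘ unmod

  private
    ∣-resp-≡ : ∀ {x y} → x ≡ y → + p ℤₛ.∣ x → + p ℤₛ.∣ y
    ∣-resp-≡ = ≡.subst (+ p ℤₛ.∣_)

    sub-cancel : ∀ a → a - a ≡ + 0
    sub-cancel = ℤ.+-inverseʳ
    sub-sym : ∀ a b → - (a - b) ≡ b - a
    sub-sym = solve-∀
    sub-trans : ∀ a b c → (a - b) + (b - c) ≡ a - c
    sub-trans = solve-∀
    sub-+ : ∀ a b c d → (a - b) + (c - d) ≡ (a + c) - (b + d)
    sub-+ = solve-∀
    sub-* : ∀ a b c d → a * (c - d) + (a - b) * d ≡ a * c - b * d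
    sub-* = solve-∀
    sub-neg : ∀ a b → - (a - b) ≡ - a - - b
    sub-neg = solve-∀

  ≈ₚ-isEquivalence : IsEquivalence _≈ₚ_
  ≈ₚ-isEquivalence = record
    { refl = λ {a} → ∣⇒≈ₚ (∣-resp-≡ (≡.sym (sub-cancel a)) (ℤₛ.divides (+ 0) ≡.refl))
    ; sym = λ {a} {b} e → ∣⇒≈ₚ (∣-resp-≡ (sub-sym a b) (ℤₛ.∣m⇒∣-m (≈ₚ⇒∣ e)))
    ; trans = λ {a} {b} {c} e f → ∣⇒≈ₚ (∣-resp-≡ (sub-trans a b c) (ℤₛ.∣m∣n⇒∣m+n (≈ₚ⇒∣ e) (≈ₚ⇒∣ f)))
    }

  ℤₚ : CommutativeRing 0ℓ 0ℓ
  ℤₚ = QuotientRing.commutativeRing ℤ.+-*-isCommutativeRing ≈ₚ-isEquivalence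
    (λ {a} {b} {c} {d} e f → ∣⇒≈ₚ (∣-resp-≡ (sub-+ a b c d) (ℤₛ.∣m∣n⇒∣m+n (≈ₚ⇒∣ e) (≈ₚ⇒∣ f))))
    (λ {a} {b} {c} {d} e f → ∣⇒≈ₚ (∣-resp-≡ (sub-* a b c d)
      (ℤₛ.∣m∣n⇒∣m+n (ℤₛ.∣n⇒∣m*n a (≈ₚ⇒∣ f)) (ℤₛ.∣m⇒∣m*n d (≈ₚ⇒∣ e)))))
    (λ {a} {b} e → ∣⇒≈ₚ (∣-resp-≡ (sub-neg a b) (ℤₛ.∣m⇒∣-m (≈ₚ⇒∣ e))))

  infix 4 _≟ₚ_
  _≟ₚ_ : Decidable _≈ₚ_
  a ≟ₚ b = Dec.map′ mod unmod (p ℕ.∣? ℤ.∣ a - b ∣)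

  ∣⇒≈ₚ0 : ∀ {a} → + p ℤᵤ.∣ a → a ≈ₚ + 0
  ∣⇒≈ₚ0 {a} = mod ∘ ≡.subst (λ x → p ℕ.∣ ℤ.∣ x ∣) (≡.sym (ℤ.+-identityʳ a))

  ≈ₚ0⇒∣ : ∀ {a} → a ≈ₚ + 0 → + p ℤᵤ.∣ a
  ≈ₚ0⇒∣ {a} = ≡.subst (λ x → p ℕ.∣ ℤ.∣ x ∣) (ℤ.+-identityʳ a) ∘ unmod

  ℤₚ-zero-divisor : ∀ a b → a * b ≈ₚ + 0 → a ≈ₚ + 0 ⊎ b ≈ₚ + 0
  ℤₚ-zero-divisor a b ab≈0 = Sum.map ∣⇒≈ₚ0 ∣⇒≈ₚ0
    (euclidsLemma ℤ.∣ a ∣ ℤ.∣ b ∣ p-prime (≡.subst (p ℕ.∣_) (ℤ.abs-* a b) (≈ₚ0⇒∣ ab≈0)))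

  1≉ₚ0 : ¬ + 1 ≈ₚ + 0
  1≉ₚ0 1≈0 = ℕ.nonTrivial⇒≢1 ⦃ prime⇒nonTrivial p-prime ⦄ (ℕ.∣1⇒≡1 (≈ₚ0⇒∣ 1≈0))

  residue : ∀ x → ∃[ k ] k ℕ.< p × x ≈ₚ + k
  residue x = x ℤ.%ℕ p , ℤ.n%ℕd<d x p , ∣⇒≈ₚ (ℤₛ.divides (x ℤ./ℕ p) (begin
    x - + (x ℤ.%ℕ p)                                   ≡⟨ ≡.cong (_- + (x ℤ.%ℕ p)) (ℤ.a≡a%ℕn+[a/ℕn]*n x p) ⟩
    + (x ℤ.%ℕ p) + x ℤ./ℕ p * + p - + (x ℤ.%ℕ p)       ≡⟨ cancel (+ (x ℤ.%ℕ p)) (x ℤ./ℕ p * + p) ⟩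
    x ℤ./ℕ p * + p                                     ∎))
    where
    open ≡.≡-Reasoning
    cancel : ∀ r s → r + s - r ≡ s
    cancel = solve-∀

  residue-injective : ∀ {k l} → k ℕ.< p → l ℕ.< p → + k ≈ₚ + l → k ≡ l
  residue-injective {k} {l} k<p l<p k≈l =
    ℤ.+-injective (ℤ.i-j≡0⇒i≡j (+ k) (+ l) (ℤ.∣i∣≡0⇒i≡0 (small-multiple (unmod k≈l) bound)))
    where
    bound : ℤ.∣ + k - + l ∣ ℕ.< p
    bound = ℕ.≤-<-trans (≡.subst (ℕ._≤ k ℕ.⊔ l) (≡.cong ℤ.∣_∣ (≡.sym (ℤ.m-n≡m⊖n k l))) (ℤ.∣m⊝n∣≤m⊔n k l))
                        (ℕ.⊔-lub k<p l<p)
    small-multiple : ∀ {n} → p ℕ.∣ n → n ℕ.< p → n ≡ 0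
    small-multiple {zero}  _   _   = ≡.refl
    small-multiple {suc n} p∣n n<p = contradiction (ℕ.∣⇒≤ p∣n) (ℕ.<⇒≱ n<p)

  ℤₚ-ι : ℤ.+-*-rawRing -Raw-AlmostCommutative⟶ fromCommutativeRing ℤₚ
  ℤₚ-ι = record
    { ⟦_⟧ = id ; +-homo = λ _ _ → ≈ₚ-refl ; *-homo = λ _ _ → ≈ₚ-refl ; -‿homo = λ _ → ≈ₚ-refl
    ; 0-homo = ≈ₚ-refl ; 1-homo = ≈ₚ-refl }
    where ≈ₚ-refl = IsEquivalence.refl ≈ₚ-isEquivalence

  module ℤₚ-Domain = IntegralDomain ℤₚ ℤₚ-ι _≟ₚ_ 1≉ₚ0 ℤₚ-zero-divisor
  open ℤₚ-Domain using (_∈_; Unique)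

  units : List ℤ
  units = applyUpTo (+_ ∘ suc) (ℕ.pred p)

  private
    <pred⇒suc< : ∀ {i} → i ℕ.< ℕ.pred p → suc i ℕ.< p
    <pred⇒suc< {i} i<p-1 = ≡.subst (suc i ℕ.<_) (ℕ.suc-pred p) (s≤s i<p-1)

    0<p : 0 ℕ.< p
    0<p = ℕ.>-nonZero⁻¹ p

  ≉0⇒∈units : ∀ {x} → ¬ x ≈ₚ + 0 → x ∈ units
  ≉0⇒∈units {x} x≉0 with residue x
  ... | zero  , _   , x≈0  = contradiction x≈0 x≉0
  ... | suc i , i<p , x≈i+1 = Any.applyUpTo⁺ (+_ ∘ suc) x≈i+1
    (ℕ.≤-pred (≡.subst (suc (suc i) ℕ.≤_) (≡.sym (ℕ.suc-pred p)) i<p))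

  ∈units⇒≉0 : ∀ {x} → x ∈ units → ¬ x ≈ₚ + 0
  ∈units⇒≉0 x∈units x≈0 with Any.applyUpTo⁻ (+_ ∘ suc) x∈units
  ... | i , i<p-1 , x≈i+1 = case residue-injective (<pred⇒suc< i<p-1) 0<p (ℤₚ.trans (ℤₚ.sym x≈i+1) x≈0) of λ ()
    where module ℤₚ = CommutativeRing ℤₚ

  units! : Unique units
  units! = AllPairs.applyUpTo⁺₁ (+_ ∘ suc) (ℕ.pred p) λ i<j j<p-1 i+1≈j+1 →
    ℕ.<-irrefl (ℕ.suc-injective (residue-injective (<pred⇒suc< (ℕ.<-trans i<j j<p-1)) (<pred⇒suc< j<p-1) i+1≈j+1)) i<j

  units-closed : ∀ {a b} → a ∈ units → b ∈ units → a * b ∈ units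
  units-closed {a} {b} a∈units b∈units =
    ≉0⇒∈units ([ ∈units⇒≉0 a∈units , ∈units⇒≉0 b∈units ]′ ∘ ℤₚ-zero-divisor a b)

  module Units = ℤₚ-Domain.FiniteSubgroup units units! units-closed (≉0⇒∈units 1≉ₚ0) ∈units⇒≉0

  length-units : length units ≡ ℕ.pred p
  length-units = List.length-applyUpTo (+_ ∘ suc) (ℕ.pred p)

  -- Opaque: unfolding the witness, a power of x, makes conversion checking in later proofs explode.
  opaque
    inverse : ∀ {x} → ¬ x ≈ₚ + 0 → ∃[ y ] x * y ≈ₚ + 1
    inverse x≉0 = let w , _ , xw≈1 = Units.∈H⇒invertible (≉0⇒∈units x≉0) in w , xw≈1

module LucasIdentities (P Q : ℤ) where

  open import Data.Integer.Base using (_+_; _-_; _*_; _^_)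
  open ≡.≡-Reasoning

  V≡2U-PU : ∀ n → V P Q n ≡ + 2 * U P Q (suc n) - P * U P Q n
  V≡2U-PU zero          = base₀ P
    where base₀ : ∀ P → + 2 ≡ + 2 * + 1 - P * + 0
          base₀ = solve-∀
  V≡2U-PU (suc zero)    = base₁ P Q
    where base₁ : ∀ P Q → P ≡ + 2 * (P * + 1 - Q * + 0) - P * + 1
          base₁ = solve-∀
  V≡2U-PU (suc (suc n)) = begin
    P * V P Q (suc n) - Q * V P Q n
      ≡⟨ ≡.cong₂ (λ v w → P * v - Q * w) (V≡2U-PU (suc n)) (V≡2U-PU n) ⟩
    P * (+ 2 * (P * a - Q * b) - P * a) - Q * (+ 2 * a - P * b)
      ≡⟨ step P Q a b ⟩
    + 2 * (P * (P * a - Q * b) - Q * a) - P * (P * a - Q * b)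
      ∎
    where
    a = U P Q (suc n)
    b = U P Q n
    step : ∀ P Q a b → P * (+ 2 * (P * a - Q * b) - P * a) - Q * (+ 2 * a - P * b)
                     ≡ + 2 * (P * (P * a - Q * b) - Q * a) - P * (P * a - Q * b)
    step = solve-∀

  U-cassini : ∀ n → U P Q (suc n) * U P Q (suc n) - P * U P Q (suc n) * U P Q n + Q * U P Q n * U P Q n ≡ Q ^ n
  U-cassini zero    = base P Q
    where base : ∀ P Q → + 1 * + 1 - P * + 1 * + 0 + Q * + 0 * + 0 ≡ + 1
          base = solve-∀
  U-cassini (suc n) = ≡.trans (step P Q (U P Q (suc n)) (U P Q n)) (≡.cong (Q *_) (U-cassini n))
    where
    step : ∀ P Q a b → (P * a - Q * b) * (P * a - Q * b) - P * (P * a - Q * b) * a + Q * a * a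
                     ≡ Q * (a * a - P * a * b + Q * b * b)
    step = solve-∀

  V²-DU²≡4Qⁿ : ∀ n → V P Q n * V P Q n - disc P Q * (U P Q n * U P Q n) ≡ + 4 * Q ^ n
  V²-DU²≡4Qⁿ n = begin
    V P Q n * V P Q n - disc P Q * (U P Q n * U P Q n)
      ≡⟨ ≡.cong (λ v → v * v - disc P Q * (b * b)) (V≡2U-PU n) ⟩
    (+ 2 * a - P * b) * (+ 2 * a - P * b) - disc P Q * (b * b)
      ≡⟨ expand P Q a b ⟩
    + 4 * (a * a - P * a * b + Q * b * b)
      ≡⟨ ≡.cong (+ 4 *_) (U-cassini n) ⟩
    + 4 * Q ^ n
      ∎
    where
    a = U P Q (suc n)
    b = U P Q n
    expand : ∀ P Q a b → (+ 2 * a - P * b) * (+ 2 * a - P * b) - (P * P - + 4 * Q) * (b * b)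
                       ≡ + 4 * (a * a - P * a * b + Q * b * b)
    expand = solve-∀

*≡*⇒∣⇔∣ : ∀ {m M s r} → 0 ℕ.< m → 0 ℕ.< r → m ℕ.* M ≡ s ℕ.* r → m ℕ.∣ s ⇔ r ℕ.∣ M
*≡*⇒∣⇔∣ {m} {M} {s} {r} 0<m 0<r mM≡sr = mk⇔
  (λ m∣s → ℕ.*-cancelˡ-∣ m ⦃ ℕ.>-nonZero 0<m ⦄ (≡.subst (m ℕ.* r ℕ.∣_) (≡.sym mM≡sr) (ℕ.*-monoˡ-∣ r m∣s)))
  (λ r∣M → ℕ.*-cancelʳ-∣ r ⦃ ℕ.>-nonZero 0<r ⦄ (≡.subst (m ℕ.* r ℕ.∣_) mM≡sr (ℕ.*-monoʳ-∣ m r∣M)))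

module Lucas
  (R : CommutativeRing 0ℓ 0ℓ)
  (ι-morphism : ℤ.+-*-rawRing -Raw-AlmostCommutative⟶ fromCommutativeRing R)
  (_≟_ : Decidable (CommutativeRing._≈_ R))
  (1≉0 : Nontrivial R)
  (zero-divisor : NoZeroDivisors R)
  (p : ℕ) (p-prime : Prime p)
  (ι-p≈0 : CommutativeRing._≈_ R (_-Raw-AlmostCommutative⟶_.⟦_⟧ ι-morphism (+ p)) (CommutativeRing.0# R))
  where

  open CommutativeRing R
  open IntegralDomain R ι-morphism _≟_ 1≉0 zero-divisor public
  open Modular p p-prime using (_≈ₚ_; mod; unmod; ≈ₚ⇒∣; _≟ₚ_; inverse; ∣⇒≈ₚ0; ≈ₚ0⇒∣)
  open import Algebra.Properties.Ring ring using (x∙y⁻¹≈ε⇒x≈y)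
  open import Relation.Binary.Reasoning.Setoid setoid

  ι-resp-≈ₚ : ∀ {a b} → a ≈ₚ b → ι a ≈ ι b
  ι-resp-≈ₚ {a} {b} a≈b = let ℤₛ.divides k a-b≡kp = ≈ₚ⇒∣ a≈b in begin
    ι a                         ≡⟨ ≡.cong ι (split a b) ⟩
    ι ((a ℤ.- b) ℤ.+ b)         ≡⟨ ≡.cong (λ d → ι (d ℤ.+ b)) a-b≡kp ⟩
    ι (k ℤ.* + p ℤ.+ b)         ≈⟨ solve 0 (con (k ℤ.* + p ℤ.+ b) := con k :* con (+ p) :+ con b) refl ⟩
    ι k * ι (+ p) + ι b         ≈⟨ +-congʳ (trans (*-congˡ ι-p≈0) (zeroʳ (ι k))) ⟩
    0# + ι b                    ≈⟨ +-identityˡ (ι b) ⟩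
    ι b                         ∎
    where
    split : ∀ a b → a ≡ (a ℤ.- b) ℤ.+ b
    split = solve-∀

  ι≈0⇒≈ₚ0 : ∀ {a} → ι a ≈ 0# → a ≈ₚ + 0
  ι≈0⇒≈ₚ0 {a} ιa≈0 with a ≟ₚ + 0
  ... | yes a≈0 = a≈0
  ... | no  a≉0 = let b , ab≈1 = inverse a≉0 in contradiction (begin
    1#            ≈⟨ ι-1 ⟨
    ι (+ 1)       ≈⟨ ι-resp-≈ₚ ab≈1 ⟨
    ι (a ℤ.* b)   ≈⟨ ι-* a b ⟩
    ι a * ι b     ≈⟨ *-congʳ ιa≈0 ⟩
    0# * ι b      ≈⟨ zeroˡ (ι b) ⟩
    0#            ∎) 1≉0

  ι-≈⇒≈ₚ : ∀ {a b} → ι a ≈ ι b → a ≈ₚ b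
  ι-≈⇒≈ₚ {a} {b} ιa≈ιb = mod (≈ₚ0⇒∣ (ι≈0⇒≈ₚ0 (begin
    ι (a ℤ.- b)        ≈⟨ ι-+ a (ℤ.- b) ⟩
    ι a + ι (ℤ.- b)    ≈⟨ +-cong ιa≈ιb (ι-- b) ⟩
    ι b - ι b          ≈⟨ -‿inverseʳ (ι b) ⟩
    0#                 ∎)))

  ι≉0⇒invertible : ∀ {a} → ¬ ι a ≈ 0# → ∃[ b ] ι a * ι b ≈ 1#
  ι≉0⇒invertible {a} ιa≉0 with a ≟ₚ + 0
  ... | yes a≈0 = contradiction (trans (ι-resp-≈ₚ a≈0) ι-0) ιa≉0
  ... | no  a≉0 = let b , ab≈1 = inverse a≉0 in b , trans (sym (ι-* a b)) (trans (ι-resp-≈ₚ ab≈1) ι-1)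

  Recurrent : Carrier → Carrier → (ℕ → Carrier) → Set
  Recurrent a b x = ∀ n → x (suc (suc n)) ≈ a * x (suc n) - b * x n

  recurrent-unique : ∀ {a b x y} → Recurrent a b x → Recurrent a b y → x 0 ≈ y 0 → x 1 ≈ y 1 →
                     ∀ n → x n ≈ y n
  recurrent-unique {a} {b} {x} {y} x-rec y-rec x₀≈y₀ x₁≈y₁ n = proj₁ (agree n)
    where
    agree : ∀ n → x n ≈ y n × x (suc n) ≈ y (suc n)
    agree zero    = x₀≈y₀ , x₁≈y₁
    agree (suc n) with agree n
    ... | xₙ≈yₙ , xₙ₊₁≈yₙ₊₁ = xₙ₊₁≈yₙ₊₁ , (begin
      x (suc (suc n))                 ≈⟨ x-rec n ⟩
      a * x (suc n) - b * x n         ≈⟨ +-cong (*-congˡ xₙ₊₁≈yₙ₊₁) (-‿cong (*-congˡ xₙ≈yₙ)) ⟩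
      a * y (suc n) - b * y n         ≈⟨ y-rec n ⟨
      y (suc (suc n))                 ∎)

  powers-sum-recurrent : ∀ {α β a b} → α + β ≈ a → α * β ≈ b → Recurrent a b (λ n → α ^ n + β ^ n)
  powers-sum-recurrent {α} {β} {a} {b} α+β≈a αβ≈b n = begin
    α * (α * α ^ n) + β * (β * β ^ n)
      ≈⟨ solve 4 (λ α β A B → α :* (α :* A) :+ β :* (β :* B) := (α :+ β) :* (α :* A :+ β :* B) :- α :* β :* (A :+ B)) refl α β (α ^ n) (β ^ n) ⟩
    (α + β) * (α * α ^ n + β * β ^ n) - α * β * (α ^ n + β ^ n)
      ≈⟨ +-cong (*-congʳ α+β≈a) (-‿cong (*-congʳ αβ≈b)) ⟩
    a * (α * α ^ n + β * β ^ n) - b * (α ^ n + β ^ n)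
      ∎

  powers-difference-recurrent : ∀ {α β a b} → α + β ≈ a → α * β ≈ b → Recurrent a b (λ n → α ^ n - β ^ n)
  powers-difference-recurrent {α} {β} {a} {b} α+β≈a αβ≈b n = begin
    α * (α * α ^ n) - β * (β * β ^ n)
      ≈⟨ solve 4 (λ α β A B → α :* (α :* A) :- β :* (β :* B) := (α :+ β) :* (α :* A :- β :* B) :- α :* β :* (A :- B)) refl α β (α ^ n) (β ^ n) ⟩
    (α + β) * (α * α ^ n - β * β ^ n) - α * β * (α ^ n - β ^ n)
      ≈⟨ +-cong (*-congʳ α+β≈a) (-‿cong (*-congʳ αβ≈b)) ⟩
    a * (α * α ^ n - β * β ^ n) - b * (α ^ n - β ^ n)
      ∎

  scaled-recurrent : ∀ {a b x} c → Recurrent a b x → Recurrent a b (λ n → c * x n)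
  scaled-recurrent {a} {b} {x} c x-rec n = begin
    c * x (suc (suc n))                  ≈⟨ *-congˡ (x-rec n) ⟩
    c * (a * x (suc n) - b * x n)        ≈⟨ solve 5 (λ c a b y z → c :* (a :* y :- b :* z) := a :* (c :* y) :- b :* (c :* z)) refl c a b _ _ ⟩
    a * (c * x (suc n)) - b * (c * x n)  ∎

  ι-recurrent : ∀ {P Q} (x : ℕ → ℤ) → (∀ n → x (suc (suc n)) ≡ P ℤ.* x (suc n) ℤ.- Q ℤ.* x n) →
                Recurrent (ι P) (ι Q) (ι ∘ x)
  ι-recurrent {P} {Q} x x-rec n = trans (reflexive (≡.cong ι (x-rec n)))
    (solve 0 (con (P ℤ.* x (suc n) ℤ.- Q ℤ.* x n) := con P :* con (x (suc n)) :- con Q :* con (x n)) refl)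

  lucas-V : ∀ {α β P Q} → α + β ≈ ι P → α * β ≈ ι Q → ∀ n → α ^ n + β ^ n ≈ ι (V P Q n)
  lucas-V {α} {β} {P} {Q} α+β≈P αβ≈Q = recurrent-unique
    (powers-sum-recurrent α+β≈P αβ≈Q) (ι-recurrent (V P Q) (λ _ → ≡.refl))
    (sym (trans (ι-+ (+ 1) (+ 1)) (+-cong ι-1 ι-1)))
    (trans (+-cong (*-identityʳ α) (*-identityʳ β)) α+β≈P)

  lucas-U : ∀ {α β P Q} → α + β ≈ ι P → α * β ≈ ι Q → ∀ n → α ^ n - β ^ n ≈ (α - β) * ι (U P Q n)
  lucas-U {α} {β} {P} {Q} α+β≈P αβ≈Q = recurrent-unique
    (powers-difference-recurrent α+β≈P αβ≈Q) (scaled-recurrent (α - β) (ι-recurrent (U P Q) (λ _ → ≡.refl)))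
    (trans (-‿inverseʳ 1#) (sym (trans (*-congˡ ι-0) (zeroʳ _))))
    (trans (+-cong (*-identityʳ α) (-‿cong (*-identityʳ β))) (sym (trans (*-congˡ ι-1) (*-identityʳ _))))

  -- H stands for the group of z = x + s y with z z̄ = 1 (all units when s lies in the image of ι).
  module Criterion
    (P Q Q* : ℤ)
    (p∤2PQD : ¬ (+ p ℤᵤ.∣ + 2 ℤ.* P ℤ.* Q ℤ.* disc P Q))
    (QQ*≈1 : Q ℤ.* Q* ≈ₚ + 1)
    (s : Carrier) (s²≈D : s * s ≈ ι (disc P Q))
    (H : List Carrier) (H! : Unique H)
    (∈H-closed : ∀ {a b} → a ∈ H → b ∈ H → a * b ∈ H)
    (1∈H : 1# ∈ H)
    (∈H⇒≉0 : ∀ {a} → a ∈ H → ¬ a ≈ 0#)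
    (norm-one⇒∈H : ∀ x y → (ι x + s * ι y) * (ι x - s * ι y) ≈ 1# → ι x + s * ι y ∈ H)
    (∈H⇒trace : ∀ {z w} → z ∈ H → z * w ≈ 1# → ∃[ X ] ι X ≈ z + w)
    where

    open FiniteSubgroup H H! ∈H-closed 1∈H ∈H⇒≉0

    private
      D = disc P Q

      ι2PQD≉0 : ¬ ι (+ 2) * ι P * ι Q * ι D ≈ 0#
      ι2PQD≉0 e = p∤2PQD (≈ₚ0⇒∣ (ι≈0⇒≈ₚ0 (trans
        (solve 0 (con (+ 2 ℤ.* P ℤ.* Q ℤ.* D) := con (+ 2) :* con P :* con Q :* con D) refl) e)))

      *≈0ʳ : ∀ {x} y → x ≈ 0# → x * y ≈ 0#
      *≈0ʳ y x≈0 = trans (*-congʳ x≈0) (zeroˡ y)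

      *≈0ˡ : ∀ x {y} → y ≈ 0# → x * y ≈ 0#
      *≈0ˡ x y≈0 = trans (*-congˡ y≈0) (zeroʳ x)

    ι2≉0 : ¬ ι (+ 2) ≈ 0#
    ι2≉0 = ι2PQD≉0 ∘ *≈0ʳ (ι D) ∘ *≈0ʳ (ι Q) ∘ *≈0ʳ (ι P)

    ιP≉0 : ¬ ι P ≈ 0#
    ιP≉0 = ι2PQD≉0 ∘ *≈0ʳ (ι D) ∘ *≈0ʳ (ι Q) ∘ *≈0ˡ (ι (+ 2))

    ιD≉0 : ¬ ι D ≈ 0#
    ιD≉0 = ι2PQD≉0 ∘ *≈0ˡ (ι (+ 2) * ι P * ι Q)

    ιD≈P²-4Q : ι D ≈ ι P * ι P - ι (+ 4) * ι Q
    ιD≈P²-4Q = solve 0 (con D := con P :* con P :- con (+ 4) :* con Q) refl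

    s≉0 : ¬ s ≈ 0#
    s≉0 s≈0 = ιD≉0 (trans (sym s²≈D) (*≈0ʳ s s≈0))

    ½ : ℤ
    ½ = proj₁ (ι≉0⇒invertible ι2≉0)

    h q : Carrier
    h = ι ½
    q = ι Q*

    2h≈1 : ι (+ 2) * h ≈ 1#
    2h≈1 = proj₂ (ι≉0⇒invertible ι2≉0)

    Qq≈1 : ι Q * q ≈ 1#
    Qq≈1 = trans (sym (ι-* Q Q*)) (trans (ι-resp-≈ₚ QQ*≈1) ι-1)

    α β : Carrier
    α = (ι P + s) * h
    β = (ι P - s) * h

    α+β≈P : α + β ≈ ι P
    α+β≈P = begin
      (ι P + s) * h + (ι P - s) * h  ≈⟨ solve 3 (λ P s h → (P :+ s) :* h :+ (P :- s) :* h := P :* (con (+ 2) :* h)) refl (ι P) s h ⟩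
      ι P * (ι (+ 2) * h)            ≈⟨ *-congˡ 2h≈1 ⟩
      ι P * 1#                       ≈⟨ *-identityʳ (ι P) ⟩
      ι P                            ∎

    α-β≈s : α - β ≈ s
    α-β≈s = begin
      (ι P + s) * h - (ι P - s) * h  ≈⟨ solve 3 (λ P s h → (P :+ s) :* h :- (P :- s) :* h := s :* (con (+ 2) :* h)) refl (ι P) s h ⟩
      s * (ι (+ 2) * h)              ≈⟨ *-congˡ 2h≈1 ⟩
      s * 1#                         ≈⟨ *-identityʳ s ⟩
      s                              ∎

    αβ≈Q : α * β ≈ ι Q
    αβ≈Q = begin
      (ι P + s) * h * ((ι P - s) * h)                     ≈⟨ solve 3 (λ P s h → (P :+ s) :* h :* ((P :- s) :* h) := (P :* P :- s :* s) :* h :* h) refl (ι P) s h ⟩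
      (ι P * ι P - s * s) * h * h                         ≈⟨ *-congʳ (*-congʳ (+-congˡ (-‿cong (trans s²≈D ιD≈P²-4Q)))) ⟩
      (ι P * ι P - (ι P * ι P - ι (+ 4) * ι Q)) * h * h   ≈⟨ solve 3 (λ P Q h → (P :* P :- (P :* P :- con (+ 4) :* Q)) :* h :* h := Q :* (con (+ 2) :* h) :* (con (+ 2) :* h)) refl (ι P) (ι Q) h ⟩
      ι Q * (ι (+ 2) * h) * (ι (+ 2) * h)                 ≈⟨ *-cong (*-congˡ 2h≈1) 2h≈1 ⟩
      ι Q * 1# * 1#                                       ≈⟨ trans (*-identityʳ _) (*-identityʳ _) ⟩
      ι Q                                                 ∎

    αβq≈1 : α * β * q ≈ 1#
    αβq≈1 = trans (*-congʳ αβ≈Q) Qq≈1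

    γ γ′ : Carrier
    γ  = α * α * q
    γ′ = β * β * q

    γγ′≈1 : γ * γ′ ≈ 1#
    γγ′≈1 = begin
      α * α * q * (β * β * q)        ≈⟨ solve 3 (λ α β q → α :* α :* q :* (β :* β :* q) := (α :* β :* q) :* (α :* β :* q)) refl α β q ⟩
      (α * β * q) * (α * β * q)      ≈⟨ *-cong αβq≈1 αβq≈1 ⟩
      1# * 1#                        ≈⟨ *-identityʳ 1# ⟩
      1#                             ∎

    γβ≈α : γ * β ≈ α
    γβ≈α = begin
      α * α * q * β      ≈⟨ solve 3 (λ α β q → α :* α :* q :* β := α :* (α :* β :* q)) refl α β q ⟩
      α * (α * β * q)    ≈⟨ *-congˡ αβq≈1 ⟩
      α * 1#             ≈⟨ *-identityʳ α ⟩
      α                  ∎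

    c : ℤ
    c = P ℤ.* P ℤ.* Q* ℤ.- + 2

    γ+γ′≈c : γ + γ′ ≈ ι c
    γ+γ′≈c = begin
      α * α * q + β * β * q                      ≈⟨ solve 3 (λ α β q → α :* α :* q :+ β :* β :* q := (α :+ β) :* (α :+ β) :* q :- con (+ 2) :* (α :* β :* q)) refl α β q ⟩
      (α + β) * (α + β) * q - ι (+ 2) * (α * β * q) ≈⟨ +-cong (*-congʳ (*-cong α+β≈P α+β≈P)) (-‿cong (trans (*-congˡ αβq≈1) (*-identityʳ _))) ⟩
      ι P * ι P * q - ι (+ 2)                    ≈⟨ solve 0 (con c := con P :* con P :* con Q* :- con (+ 2)) refl ⟨
      ι c                                        ∎

    x₀ y₀ : ℤ
    x₀ = (P ℤ.* P ℤ.+ D) ℤ.* ½ ℤ.* ½ ℤ.* Q*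
    y₀ = + 2 ℤ.* P ℤ.* ½ ℤ.* ½ ℤ.* Q*

    γ≈x₀+sy₀ : γ ≈ ι x₀ + s * ι y₀
    γ≈x₀+sy₀ = begin
      (ι P + s) * h * ((ι P + s) * h) * q
        ≈⟨ solve 4 (λ P s h q → (P :+ s) :* h :* ((P :+ s) :* h) :* q := (P :* P :+ s :* s) :* h :* h :* q :+ s :* (con (+ 2) :* P :* h :* h :* q)) refl (ι P) s h q ⟩
      (ι P * ι P + s * s) * h * h * q + s * (ι (+ 2) * ι P * h * h * q)
        ≈⟨ +-congʳ (*-congʳ (*-congʳ (*-congʳ (+-congˡ s²≈D)))) ⟩
      (ι P * ι P + ι D) * h * h * q + s * (ι (+ 2) * ι P * h * h * q)
        ≈⟨ +-cong (solve 0 (con x₀ := (con P :* con P :+ con D) :* con ½ :* con ½ :* con Q*) refl)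
                  (*-congˡ (solve 0 (con y₀ := con (+ 2) :* con P :* con ½ :* con ½ :* con Q*) refl)) ⟨
      ι x₀ + s * ι y₀
        ∎

    γ′≈x₀-sy₀ : γ′ ≈ ι x₀ - s * ι y₀
    γ′≈x₀-sy₀ = begin
      (ι P - s) * h * ((ι P - s) * h) * q
        ≈⟨ solve 4 (λ P s h q → (P :- s) :* h :* ((P :- s) :* h) :* q := (P :* P :+ s :* s) :* h :* h :* q :- s :* (con (+ 2) :* P :* h :* h :* q)) refl (ι P) s h q ⟩
      (ι P * ι P + s * s) * h * h * q - s * (ι (+ 2) * ι P * h * h * q)
        ≈⟨ +-congʳ (*-congʳ (*-congʳ (*-congʳ (+-congˡ s²≈D)))) ⟩
      (ι P * ι P + ι D) * h * h * q - s * (ι (+ 2) * ι P * h * h * q)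
        ≈⟨ +-cong (solve 0 (con x₀ := (con P :* con P :+ con D) :* con ½ :* con ½ :* con Q*) refl)
                  (-‿cong (*-congˡ (solve 0 (con y₀ := con (+ 2) :* con P :* con ½ :* con ½ :* con Q*) refl))) ⟨
      ι x₀ - s * ι y₀
        ∎

    γ∈H : γ ∈ H
    γ∈H = ∈-resp-≈ setoid (sym γ≈x₀+sy₀) (norm-one⇒∈H x₀ y₀ (trans (sym (*-cong γ≈x₀+sy₀ γ′≈x₀-sy₀)) γγ′≈1))

    β≉0 : ¬ β ≈ 0#
    β≉0 = unit≉0 (trans (solve 3 (λ α β q → β :* (α :* q) := α :* β :* q) refl α β q) αβq≈1)

    γᵏ≈1⇔αᵏ≈βᵏ : ∀ k → γ ^ k ≈ 1# ⇔ α ^ k ≈ β ^ k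
    γᵏ≈1⇔αᵏ≈βᵏ k = mk⇔
      (λ γᵏ≈1 → begin
        α ^ k           ≈⟨ γᵏβᵏ≈αᵏ ⟨
        γ ^ k * β ^ k   ≈⟨ *-congʳ γᵏ≈1 ⟩
        1# * β ^ k      ≈⟨ *-identityˡ _ ⟩
        β ^ k           ∎)
      (λ αᵏ≈βᵏ → *-cancelʳ (^≉0 k β≉0) (begin
        γ ^ k * β ^ k   ≈⟨ γᵏβᵏ≈αᵏ ⟩
        α ^ k           ≈⟨ αᵏ≈βᵏ ⟩
        β ^ k           ≈⟨ *-identityˡ _ ⟨
        1# * β ^ k      ∎))
      where
      γᵏβᵏ≈αᵏ : γ ^ k * β ^ k ≈ α ^ k
      γᵏβᵏ≈αᵏ = trans (sym (^-distrib-* γ β k)) (^-congˡ k γβ≈α)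

    αᵏ≈βᵏ⇔p∣Uₖ : ∀ k → α ^ k ≈ β ^ k ⇔ + p ℤᵤ.∣ U P Q k
    αᵏ≈βᵏ⇔p∣Uₖ k = mk⇔
      (λ αᵏ≈βᵏ → ≈ₚ0⇒∣ (ι≈0⇒≈ₚ0 ([ (λ s≈0 → contradiction s≈0 s≉0) , id ]′ (zero-divisor s _ (begin
        s * ι (U P Q k)          ≈⟨ *-congʳ α-β≈s ⟨
        (α - β) * ι (U P Q k)    ≈⟨ lucas-U α+β≈P αβ≈Q k ⟨
        α ^ k - β ^ k            ≈⟨ +-congʳ αᵏ≈βᵏ ⟩
        β ^ k - β ^ k            ≈⟨ -‿inverseʳ _ ⟩
        0#                       ∎)))))
      (λ p∣Uₖ → x∙y⁻¹≈ε⇒x≈y _ _ (begin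
        α ^ k - β ^ k            ≈⟨ lucas-U α+β≈P αβ≈Q k ⟩
        (α - β) * ι (U P Q k)    ≈⟨ *-congˡ (trans (ι-resp-≈ₚ (∣⇒≈ₚ0 p∣Uₖ)) ι-0) ⟩
        (α - β) * 0#             ≈⟨ zeroʳ _ ⟩
        0#                       ∎))

    γᵏ≈1⇔p∣Uₖ : ∀ k → γ ^ k ≈ 1# ⇔ + p ℤᵤ.∣ U P Q k
    γᵏ≈1⇔p∣Uₖ k = ⇔.trans (γᵏ≈1⇔αᵏ≈βᵏ k) (αᵏ≈βᵏ⇔p∣Uₖ k)

    V-of-trace : ∀ {z w X} m → z * w ≈ 1# → ι X ≈ z + w → ι (V X (+ 1) m) ≈ z ^ m + w ^ m
    V-of-trace m zw≈1 ιX≈z+w = sym (lucas-V (sym ιX≈z+w) (trans zw≈1 (sym ι-1)) m)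

    mth-power⇒V-solvable : ∀ m {t} → t ∈ H → t ^ m ≈ γ → ∃[ X ] V X (+ 1) m ≡ c [mod p ]
    mth-power⇒V-solvable m {t} t∈H tᵐ≈γ =
      let w , _ , tw≈1 = ∈H⇒invertible t∈H
          X , ιX≈t+w   = ∈H⇒trace t∈H tw≈1
          wᵐ≈γ′ : w ^ m ≈ γ′
          wᵐ≈γ′ = inverse-unique (trans (*-congʳ (sym tᵐ≈γ)) (^-unit m tw≈1)) γγ′≈1
      in X , unmod (ι-≈⇒≈ₚ (begin
        ι (V X (+ 1) m)   ≈⟨ V-of-trace m tw≈1 ιX≈t+w ⟩
        t ^ m + w ^ m     ≈⟨ +-cong tᵐ≈γ wᵐ≈γ′ ⟩
        γ + γ′            ≈⟨ γ+γ′≈c ⟩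
        ι c               ∎))

    square⇒conjugate-pair : ∀ X y → ι X * ι X - ι (+ 4) ≈ ι D * (ι y * ι y) →
                            ∃₂ λ z z̄ → (z ∈ H × z̄ ∈ H) × (z + z̄ ≈ ι X × z * z̄ ≈ 1#)
    square⇒conjugate-pair X y X²-4≈Dy² = z , z̄ , (z∈H , z̄∈H) , (z+z̄≈X , zz̄≈1)
      where
      x₁ y₁ : ℤ
      x₁ = X ℤ.* ½
      y₁ = y ℤ.* ½
      z z̄ : Carrier
      z  = ι x₁ + s * ι y₁
      z̄ = ι x₁ - s * ι y₁

      z+z̄≈X : z + z̄ ≈ ι X
      z+z̄≈X = begin
        ι x₁ + s * ι y₁ + (ι x₁ - s * ι y₁)  ≈⟨ solve 2 (λ x sy → x :+ sy :+ (x :- sy) := con (+ 2) :* x) refl (ι x₁) (s * ι y₁) ⟩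
        ι (+ 2) * ι x₁                       ≈⟨ *-congˡ (ι-* X ½) ⟩
        ι (+ 2) * (ι X * h)                  ≈⟨ solve 3 (λ t X h → t :* (X :* h) := X :* (t :* h)) refl (ι (+ 2)) (ι X) h ⟩
        ι X * (ι (+ 2) * h)                  ≈⟨ *-congˡ 2h≈1 ⟩
        ι X * 1#                             ≈⟨ *-identityʳ (ι X) ⟩
        ι X                                  ∎

      zz̄≈1 : z * z̄ ≈ 1#
      zz̄≈1 = begin
        (ι x₁ + s * ι y₁) * (ι x₁ - s * ι y₁)           ≈⟨ *-cong (+-cong (ι-* X ½) (*-congˡ (ι-* y ½))) (+-cong (ι-* X ½) (-‿cong (*-congˡ (ι-* y ½)))) ⟩
        (ι X * h + s * (ι y * h)) * (ι X * h - s * (ι y * h))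
          ≈⟨ solve 4 (λ X y s h → (X :* h :+ s :* (y :* h)) :* (X :* h :- s :* (y :* h)) := (X :* X :- s :* s :* (y :* y)) :* h :* h) refl (ι X) (ι y) s h ⟩
        (ι X * ι X - s * s * (ι y * ι y)) * h * h       ≈⟨ *-congʳ (*-congʳ (+-congˡ (-‿cong (trans (*-congʳ s²≈D) (sym X²-4≈Dy²))))) ⟩
        (ι X * ι X - (ι X * ι X - ι (+ 4))) * h * h     ≈⟨ solve 2 (λ X h → (X :* X :- (X :* X :- con (+ 4))) :* h :* h := (con (+ 2) :* h) :* (con (+ 2) :* h)) refl (ι X) h ⟩
        (ι (+ 2) * h) * (ι (+ 2) * h)                   ≈⟨ *-cong 2h≈1 2h≈1 ⟩
        1# * 1#                                          ≈⟨ *-identityʳ 1# ⟩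
        1#                                               ∎

      z∈H : z ∈ H
      z∈H = norm-one⇒∈H x₁ y₁ zz̄≈1

      z̄≈x₁+s[-y₁] : ι x₁ + s * ι (ℤ.- y₁) ≈ z̄
      z̄≈x₁+s[-y₁] = +-congˡ (trans (*-congˡ (ι-- y₁)) (solve 2 (λ s y → s :* (:- y) := :- (s :* y)) refl s (ι y₁)))

      z≈x₁-s[-y₁] : ι x₁ - s * ι (ℤ.- y₁) ≈ z
      z≈x₁-s[-y₁] = +-congˡ (trans (-‿cong (*-congˡ (ι-- y₁))) (solve 2 (λ s y → :- (s :* (:- y)) := s :* y) refl s (ι y₁)))

      z̄∈H : z̄ ∈ H
      z̄∈H = ∈-resp-≈ setoid z̄≈x₁+s[-y₁]
        (norm-one⇒∈H x₁ (ℤ.- y₁) (trans (*-cong z̄≈x₁+s[-y₁] z≈x₁-s[-y₁]) (trans (*-comm z̄ z) zz̄≈1)))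

    V≈c⇒square : ∀ m X → V X (+ 1) m ≈ₚ c → ∃[ y ] ι X * ι X - ι (+ 4) ≈ ι D * (ι y * ι y)
    V≈c⇒square m X Vₘ≈c = y , (begin
      ι X * ι X - ι (+ 4)                                  ≈⟨ *-identityʳ _ ⟨
      (ι X * ι X - ι (+ 4)) * 1#                           ≈⟨ *-congˡ (trans (*-cong uu*≈1 uu*≈1) (*-identityʳ 1#)) ⟨
      (ι X * ι X - ι (+ 4)) * ((u * u*) * (u * u*))        ≈⟨ solve 3 (λ d u v → d :* ((u :* v) :* (u :* v)) := d :* (u :* u) :* (v :* v)) refl _ u u* ⟩
      (ι X * ι X - ι (+ 4)) * (u * u) * (u* * u*)          ≈⟨ *-congʳ X²-4u²≈Dw² ⟩
      ι D * (w * w) * (u* * u*)                            ≈⟨ solve 3 (λ d w v → d :* (w :* w) :* (v :* v) := d :* ((w :* v) :* (w :* v))) refl (ι D) w u* ⟩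
      ι D * ((w * u*) * (w * u*))                          ≈⟨ *-congˡ (*-cong ιy≈wu* ιy≈wu*) ⟨
      ι D * (ι y * ι y)                                    ∎)
      where
      u v w : Carrier
      u = ι (U X (+ 1) m)
      v = ι (V X (+ 1) m)
      w = ι P * q

      v²-[X²-4]u²≈4 : v * v - (ι X * ι X - ι (+ 4)) * (u * u) ≈ ι (+ 4)
      v²-[X²-4]u²≈4 = begin
        v * v - (ι X * ι X - ι (+ 4)) * (u * u)
          ≈⟨ solve 0 (con (V X (+ 1) m ℤ.* V X (+ 1) m ℤ.- disc X (+ 1) ℤ.* (U X (+ 1) m ℤ.* U X (+ 1) m))
                      := con (V X (+ 1) m) :* con (V X (+ 1) m) :- (con X :* con X :- con (+ 4)) :* (con (U X (+ 1) m) :* con (U X (+ 1) m))) refl ⟨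
        ι (V X (+ 1) m ℤ.* V X (+ 1) m ℤ.- disc X (+ 1) ℤ.* (U X (+ 1) m ℤ.* U X (+ 1) m))
          ≡⟨ ≡.cong ι (≡.trans (LucasIdentities.V²-DU²≡4Qⁿ X (+ 1) m) (≡.cong (+ 4 ℤ.*_) (ℤ.^-zeroˡ m))) ⟩
        ι (+ 4)
          ∎

      X²-4u²≈Dw² : (ι X * ι X - ι (+ 4)) * (u * u) ≈ ι D * (w * w)
      X²-4u²≈Dw² = begin
        (ι X * ι X - ι (+ 4)) * (u * u)                ≈⟨ solve 2 (λ v e → e := v :* v :- (v :* v :- e)) refl v _ ⟩
        v * v - (v * v - (ι X * ι X - ι (+ 4)) * (u * u)) ≈⟨ +-congˡ (-‿cong v²-[X²-4]u²≈4) ⟩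
        v * v - ι (+ 4)                                ≈⟨ +-congʳ (*-cong v≈A-2 v≈A-2) ⟩
        (A - ι (+ 2)) * (A - ι (+ 2)) - ι (+ 4)        ≈⟨ solve 1 (λ A → (A :- con (+ 2)) :* (A :- con (+ 2)) :- con (+ 4) := A :* (A :- con (+ 4))) refl A ⟩
        A * (A - ι (+ 4))                              ≈⟨ *-congˡ (+-congˡ (-‿cong (trans (*-congˡ Qq≈1) (*-identityʳ _)))) ⟨
        A * (A - ι (+ 4) * (ι Q * q))                  ≈⟨ solve 3 (λ P Q q → P :* P :* q :* (P :* P :* q :- con (+ 4) :* (Q :* q)) := (P :* P :- con (+ 4) :* Q) :* ((P :* q) :* (P :* q))) refl (ι P) (ι Q) q ⟩
        (ι P * ι P - ι (+ 4) * ι Q) * (w * w)          ≈⟨ *-congʳ ιD≈P²-4Q ⟨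
        ι D * (w * w)                                  ∎
        where
        A = ι P * ι P * q
        v≈A-2 : v ≈ A - ι (+ 2)
        v≈A-2 = trans (ι-resp-≈ₚ Vₘ≈c) (solve 0 (con c := con P :* con P :* con Q* :- con (+ 2)) refl)

      u≉0 : ¬ u ≈ 0#
      u≉0 u≈0 = [ ιD≉0 , [ w≉0 , w≉0 ]′ ∘ zero-divisor w w ]′ (zero-divisor (ι D) (w * w) (begin
        ι D * (w * w)                      ≈⟨ X²-4u²≈Dw² ⟨
        (ι X * ι X - ι (+ 4)) * (u * u)    ≈⟨ *≈0ˡ _ (*≈0ʳ u u≈0) ⟩
        0#                                 ∎))
        where
        w≉0 : ¬ w ≈ 0#
        w≉0 = [ ιP≉0 , unit≉0 (trans (*-comm q (ι Q)) Qq≈1) ]′ ∘ zero-divisor (ι P) q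

      U* = proj₁ (ι≉0⇒invertible u≉0)
      u* = ι U*
      uu*≈1 : u * u* ≈ 1#
      uu*≈1 = proj₂ (ι≉0⇒invertible u≉0)

      y : ℤ
      y = P ℤ.* Q* ℤ.* U*

      ιy≈wu* : ι y ≈ w * u*
      ιy≈wu* = solve 0 (con y := con P :* con Q* :* con U*) refl

    conjugate-pair⇒mth-power : ∀ m {X z z̄} → z ∈ H → z̄ ∈ H → z + z̄ ≈ ι X → z * z̄ ≈ 1# →
                               ι (V X (+ 1) m) ≈ ι c → ∃[ t ] t ∈ H × t ^ m ≈ γ
    conjugate-pair⇒mth-power m {X} {z} {z̄} z∈H z̄∈H z+z̄≈X zz̄≈1 Vₘ≈c =
      [ (λ zᵐ≈γ → z , z∈H , zᵐ≈γ)
      , (λ zᵐ≈γ′ → z̄ , z̄∈H , inverse-unique zᵐz̄ᵐ≈1 (trans (*-congʳ zᵐ≈γ′) (trans (*-comm γ′ γ) γγ′≈1)))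
      ]′ (sum-product-determine zᵐ+z̄ᵐ≈γ+γ′ (trans zᵐz̄ᵐ≈1 (sym γγ′≈1)))
      where
      zᵐz̄ᵐ≈1 : z ^ m * z̄ ^ m ≈ 1#
      zᵐz̄ᵐ≈1 = ^-unit m zz̄≈1
      zᵐ+z̄ᵐ≈γ+γ′ : z ^ m + z̄ ^ m ≈ γ + γ′
      zᵐ+z̄ᵐ≈γ+γ′ = begin
        z ^ m + z̄ ^ m     ≈⟨ V-of-trace m zz̄≈1 (sym z+z̄≈X) ⟨
        ι (V X (+ 1) m)   ≈⟨ Vₘ≈c ⟩
        ι c               ≈⟨ γ+γ′≈c ⟨
        γ + γ′            ∎

    V-solvable⇒mth-power : ∀ m → (∃[ X ] V X (+ 1) m ≡ c [mod p ]) → ∃[ t ] t ∈ H × t ^ m ≈ γ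
    V-solvable⇒mth-power m (X , Vₘ≡c) =
      let y , X²-4≈Dy² = V≈c⇒square m X (mod Vₘ≡c)
          _ , _ , (z∈H , z̄∈H) , (z+z̄≈X , zz̄≈1) = square⇒conjugate-pair X y X²-4≈Dy²
      in conjugate-pair⇒mth-power m z∈H z̄∈H z+z̄≈X zz̄≈1 (ι-resp-≈ₚ (mod Vₘ≡c))

    V-solvable⇔γᴹ≈1 : ∀ {m M} → 0 ℕ.< m → m ℕ.* M ≡ order → (∃[ X ] V X (+ 1) m ≡ c [mod p ]) ⇔ γ ^ M ≈ 1#
    V-solvable⇔γᴹ≈1 {m} {M} 0<m mM≡order = mk⇔
      (λ solvable → let t , t∈H , tᵐ≈γ = V-solvable⇒mth-power m solvable in
        trans (^-congˡ M (sym tᵐ≈γ)) (mth-power⇒^M≈1 {m} {M} mM≡order t∈H))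
      (λ γᴹ≈1 → let t , t∈H , tᵐ≈γ = ^M≈1⇒mth-power 0<m mM≡order γ∈H γᴹ≈1 in
        mth-power⇒V-solvable m t∈H tᵐ≈γ)

    -- With N = m M = S r:  m ∣ S ⇔ r ∣ M ⇔ γᴹ = 1 ⇔ ∃ X. Vₘ(X, 1) ≡ c.
    divides-s⇔V-solvable : order ≡ pMinusLeg P Q p →
      (m : ℕ) → 0 ℕ.< m → m ℕ.∣ pMinusLeg P Q p → (r : ℕ) → IsRestrictedPeriod P Q p r →
      (m ℕ.∣ sOf P Q p r) ⇔ ∃ (λ X → V X (+ 1) m ≡ c [mod p ])
    divides-s⇔V-solvable _ _ _ _ zero (() , _)
    divides-s⇔V-solvable order≡N m 0<m (ℕ.divides M N≡Mm) r@(suc _) (0<r , p∣Uᵣ , r-minimal) =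
      ≡.subst (λ x → m ℕ.∣ x ⇔ _) (≡.sym (ℕ.n/m≡quotient r∣N))
        (⇔.trans (*≡*⇒∣⇔∣ 0<m 0<r mM≡Sr) (⇔.sym (⇔.trans (V-solvable⇔γᴹ≈1 0<m mM≡order) (γᵏ≈1⇔r∣k M))))
      where
      γᵏ≈1⇔r∣k : ∀ k → γ ^ k ≈ 1# ⇔ r ℕ.∣ k
      γᵏ≈1⇔r∣k = ^≈1⇔order∣ 0<r (Equivalence.from (γᵏ≈1⇔p∣Uₖ r) p∣Uᵣ)
        (λ t 0<t t<r γᵗ≈1 → r-minimal t 0<t t<r (Equivalence.to (γᵏ≈1⇔p∣Uₖ t) γᵗ≈1))

      r∣N : r ℕ.∣ pMinusLeg P Q p
      r∣N = ≡.subst (r ℕ.∣_) order≡N (Equivalence.to (γᵏ≈1⇔r∣k order) (lagrange γ∈H))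

      S : ℕ
      S = ℕ.quotient r∣N

      mM≡order : m ℕ.* M ≡ order
      mM≡order = ≡.trans (ℕ.*-comm m M) (≡.trans (≡.sym N≡Mm) (≡.sym order≡N))

      mM≡Sr : m ℕ.* M ≡ S ℕ.* r
      mM≡Sr = ≡.trans (ℕ.*-comm m M) (≡.trans (≡.sym N≡Mm) (ℕ._∣_.equality r∣N))

module QuadraticExtension
  (p : ℕ) (p-prime : Prime p) (p≢2 : p ≢ 2)
  (D : ℤ) (D-nonsquare : ∀ y → ¬ (y ℤ.* y) ≡ D [mod p ])
  where

  open Modular p p-prime
  open import Data.Integer.Base using (_+_; _-_; _*_; -_)
  private module ℤₚ = CommutativeRing ℤₚ

  -- a + b √D is represented by the pair (a , b).
  infixl 6 _⊕_
  infixl 7 _⊗_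
  _⊕_ _⊗_ : ℤ × ℤ → ℤ × ℤ → ℤ × ℤ
  (a , b) ⊕ (c , d) = a + c , b + d
  (a , b) ⊗ (c , d) = a * c + D * (b * d) , a * d + b * c

  ⊖_ : ℤ × ℤ → ℤ × ℤ
  ⊖ (a , b) = - a , - b

  0ₖ 1ₖ √D : ℤ × ℤ
  0ₖ = + 0 , + 0
  1ₖ = + 1 , + 0
  √D = + 0 , + 1

  private
    pair : ∀ {a b c d : ℤ} → a ≡ c → b ≡ d → (a , b) ≡ (c , d)
    pair = ≡.cong₂ _,_

    ⊗-assoc₁ : ∀ D a b c d e f → (a * c + D * (b * d)) * e + D * ((a * d + b * c) * f)
                               ≡ a * (c * e + D * (d * f)) + D * (b * (c * f + d * e))
    ⊗-assoc₁ = solve-∀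
    ⊗-assoc₂ : ∀ D a b c d e f → (a * c + D * (b * d)) * f + (a * d + b * c) * e
                               ≡ a * (c * f + d * e) + b * (c * e + D * (d * f))
    ⊗-assoc₂ = solve-∀
    ⊗-identityˡ₁ : ∀ D a b → + 1 * a + D * (+ 0 * b) ≡ a
    ⊗-identityˡ₁ = solve-∀
    ⊗-identityˡ₂ : ∀ a b → + 1 * b + + 0 * a ≡ b
    ⊗-identityˡ₂ = solve-∀
    ⊗-identityʳ₁ : ∀ D a b → a * + 1 + D * (b * + 0) ≡ a
    ⊗-identityʳ₁ = solve-∀
    ⊗-identityʳ₂ : ∀ a b → a * + 0 + b * + 1 ≡ b
    ⊗-identityʳ₂ = solve-∀
    distribˡ₁ : ∀ D a b c d e f → a * (c + e) + D * (b * (d + f)) ≡ (a * c + D * (b * d)) + (a * e + D * (b * f))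
    distribˡ₁ = solve-∀
    distribˡ₂ : ∀ a b c d e f → a * (d + f) + b * (c + e) ≡ (a * d + b * c) + (a * f + b * e)
    distribˡ₂ = solve-∀
    distribʳ₁ : ∀ D a b c d e f → (c + e) * a + D * ((d + f) * b) ≡ (c * a + D * (d * b)) + (e * a + D * (f * b))
    distribʳ₁ = solve-∀
    distribʳ₂ : ∀ a b c d e f → (c + e) * b + (d + f) * a ≡ (c * b + d * a) + (e * b + f * a)
    distribʳ₂ = solve-∀
    ⊗-comm₁ : ∀ D a b c d → a * c + D * (b * d) ≡ c * a + D * (d * b)
    ⊗-comm₁ = solve-∀
    ⊗-comm₂ : ∀ a b c d → a * d + b * c ≡ c * b + d * a
    ⊗-comm₂ = solve-∀

  ⊕-⊗-isCommutativeRing : IsCommutativeRing _≡_ _⊕_ _⊗_ ⊖_ 0ₖ 1ₖ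
  ⊕-⊗-isCommutativeRing = record
    { isRing = record
      { +-isAbelianGroup = record
        { isGroup = record
          { isMonoid = record
            { isSemigroup = record
              { isMagma = record { isEquivalence = ≡.isEquivalence ; ∙-cong = ≡.cong₂ _⊕_ }
              ; assoc = λ (a , b) (c , d) (e , f) → pair (ℤ.+-assoc a c e) (ℤ.+-assoc b d f) }
            ; identity = (λ (a , b) → pair (ℤ.+-identityˡ a) (ℤ.+-identityˡ b))
                       , (λ (a , b) → pair (ℤ.+-identityʳ a) (ℤ.+-identityʳ b)) }
          ; inverse = (λ (a , b) → pair (ℤ.+-inverseˡ a) (ℤ.+-inverseˡ b))
                    , (λ (a , b) → pair (ℤ.+-inverseʳ a) (ℤ.+-inverseʳ b))
          ; ⁻¹-cong = ≡.cong ⊖_ }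
        ; comm = λ (a , b) (c , d) → pair (ℤ.+-comm a c) (ℤ.+-comm b d) }
      ; *-cong = ≡.cong₂ _⊗_
      ; *-assoc = λ (a , b) (c , d) (e , f) → pair (⊗-assoc₁ D a b c d e f) (⊗-assoc₂ D a b c d e f)
      ; *-identity = (λ (a , b) → pair (⊗-identityˡ₁ D a b) (⊗-identityˡ₂ a b))
                   , (λ (a , b) → pair (⊗-identityʳ₁ D a b) (⊗-identityʳ₂ a b))
      ; distrib = (λ (a , b) (c , d) (e , f) → pair (distribˡ₁ D a b c d e f) (distribˡ₂ a b c d e f))
                , (λ (a , b) (c , d) (e , f) → pair (distribʳ₁ D a b c d e f) (distribʳ₂ a b c d e f)) }
    ; *-comm = λ (a , b) (c , d) → pair (⊗-comm₁ D a b c d) (⊗-comm₂ a b c d) }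

  infix 4 _≈ₖ_
  _≈ₖ_ : Rel (ℤ × ℤ) 0ℓ
  _≈ₖ_ = Pointwise _≈ₚ_ _≈ₚ_

  ℤₚ[√D] : CommutativeRing 0ℓ 0ℓ
  ℤₚ[√D] = QuotientRing.commutativeRing ⊕-⊗-isCommutativeRing
    (×-isEquivalence ≈ₚ-isEquivalence ≈ₚ-isEquivalence)
    (λ (a≈c , b≈d) (e≈g , f≈h) → ℤₚ.+-cong a≈c e≈g , ℤₚ.+-cong b≈d f≈h)
    (λ (a≈c , b≈d) (e≈g , f≈h) → ℤₚ.+-cong (ℤₚ.*-cong a≈c e≈g) (ℤₚ.*-congˡ {D} (ℤₚ.*-cong b≈d f≈h))
                                , ℤₚ.+-cong (ℤₚ.*-cong a≈c f≈h) (ℤₚ.*-cong b≈d e≈g))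
    (λ (a≈c , b≈d) → ℤₚ.-‿cong a≈c , ℤₚ.-‿cong b≈d)

  open import Algebra.Properties.Ring (CommutativeRing.ring ℤₚ) using (x∙y⁻¹≈ε⇒x≈y)

  norm : ℤ × ℤ → ℤ
  norm (a , b) = a * a - D * (b * b)

  norm-⊗ : ∀ x y → norm (x ⊗ y) ≡ norm x * norm y
  norm-⊗ (a , b) (c , d) = multiplicative D a b c d
    where
    multiplicative : ∀ D a b c d → (a * c + D * (b * d)) * (a * c + D * (b * d)) - D * ((a * d + b * c) * (a * d + b * c))
                                 ≡ (a * a - D * (b * b)) * (c * c - D * (d * d))
    multiplicative = solve-∀

  norm-cong : ∀ {x y} → x ≈ₖ y → norm x ≈ₚ norm y
  norm-cong (a≈c , b≈d) = ℤₚ.+-cong (ℤₚ.*-cong a≈c a≈c) (ℤₚ.-‿cong (ℤₚ.*-congˡ {D} (ℤₚ.*-cong b≈d b≈d)))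

  norm-0 : norm 0ₖ ≡ + 0
  norm-0 = ≡.cong (λ t → + 0 - t) (ℤ.*-zeroʳ D)

  norm-1 : norm 1ₖ ≡ + 1
  norm-1 = ≡.cong (λ t → + 1 - t) (ℤ.*-zeroʳ D)

  norm≈0⇒≈0 : ∀ {x} → norm x ≈ₚ + 0 → x ≈ₖ 0ₖ
  norm≈0⇒≈0 {a , b} norm≈0 with b ≟ₚ + 0
  ... | yes b≈0 = [ id , id ]′ (ℤₚ-zero-divisor a a a²≈0) , b≈0
    where
    open import Relation.Binary.Reasoning.Setoid (CommutativeRing.setoid ℤₚ)
    a²≈0 : a * a ≈ₚ + 0
    a²≈0 = begin
      a * a              ≈⟨ x∙y⁻¹≈ε⇒x≈y (a * a) (D * (b * b)) norm≈0 ⟩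
      D * (b * b)        ≈⟨ ℤₚ.*-congˡ {D} (ℤₚ.*-cong b≈0 b≈0) ⟩
      D * (+ 0 * + 0)    ≡⟨ ℤ.*-zeroʳ D ⟩
      + 0                ∎
  ... | no b≉0 = let b⁻¹ , bb⁻¹≈1 = inverse b≉0 in contradiction (begin
      (a * b⁻¹) * (a * b⁻¹)          ≡⟨ square-* a b⁻¹ ⟩
      (a * a) * (b⁻¹ * b⁻¹)          ≈⟨ ℤₚ.*-congʳ (x∙y⁻¹≈ε⇒x≈y (a * a) (D * (b * b)) norm≈0) ⟩
      D * (b * b) * (b⁻¹ * b⁻¹)      ≡⟨ regroup D b b⁻¹ ⟩
      D * ((b * b⁻¹) * (b * b⁻¹))    ≈⟨ ℤₚ.*-congˡ {D} (ℤₚ.*-cong bb⁻¹≈1 bb⁻¹≈1) ⟩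
      D * (+ 1 * + 1)                ≡⟨ ℤ.*-identityʳ D ⟩
      D                              ∎) (D-nonsquare (a * b⁻¹) ∘ unmod)
    where
    open import Relation.Binary.Reasoning.Setoid (CommutativeRing.setoid ℤₚ)
    square-* : ∀ a c → (a * c) * (a * c) ≡ (a * a) * (c * c)
    square-* = solve-∀
    regroup : ∀ D b c → D * (b * b) * (c * c) ≡ D * ((b * c) * (b * c))
    regroup = solve-∀

  ⊗-zero-divisor : ∀ x y → x ⊗ y ≈ₖ 0ₖ → x ≈ₖ 0ₖ ⊎ y ≈ₖ 0ₖ
  ⊗-zero-divisor x y xy≈0 = Sum.map norm≈0⇒≈0 norm≈0⇒≈0 (ℤₚ-zero-divisor (norm x) (norm y)
    (ℤₚ.trans (ℤₚ.reflexive (≡.sym (norm-⊗ x y))) (ℤₚ.trans (norm-cong xy≈0) (ℤₚ.reflexive norm-0))))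

  infix 4 _≟ₖ_
  _≟ₖ_ : Decidable _≈ₖ_
  _≟ₖ_ = ×-decidable _≟ₚ_ _≟ₚ_

  1≉ₖ0 : ¬ 1ₖ ≈ₖ 0ₖ
  1≉ₖ0 (1≈0 , _) = 1≉ₚ0 1≈0

  ι : ℤ → ℤ × ℤ
  ι x = x , + 0

  ι-morphism : ℤ.+-*-rawRing -Raw-AlmostCommutative⟶ fromCommutativeRing ℤₚ[√D]
  ι-morphism = record
    { ⟦_⟧ = ι
    ; +-homo = λ _ _ → ℤₚ.refl , ℤₚ.refl
    ; *-homo = λ a b → ℤₚ.reflexive (*-homo₁ D a b) , ℤₚ.reflexive (*-homo₂ a b)
    ; -‿homo = λ _ → ℤₚ.refl , ℤₚ.refl
    ; 0-homo = ℤₚ.refl , ℤₚ.refl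
    ; 1-homo = ℤₚ.refl , ℤₚ.refl
    }
    where
    *-homo₁ : ∀ D a b → a * b ≡ a * b + D * (+ 0 * + 0)
    *-homo₁ = solve-∀
    *-homo₂ : ∀ a b → + 0 ≡ a * + 0 + + 0 * b
    *-homo₂ = solve-∀

  ι-p≈0 : ι (+ p) ≈ₖ 0ₖ
  ι-p≈0 = ∣⇒≈ₚ0 ℕ.∣-refl , ℤₚ.refl

  module ℤₚ[√D]-Lucas = Lucas ℤₚ[√D] ι-morphism _≟ₖ_ 1≉ₖ0 ⊗-zero-divisor p p-prime ι-p≈0
  open ℤₚ[√D]-Lucas using (_∈_; Unique; *-cancelʳ; inverse-unique)
  private module K = CommutativeRing ℤₚ[√D]

  √D²≈D : √D ⊗ √D ≈ₖ ι D
  √D²≈D = ℤₚ.reflexive (square D) , ℤₚ.refl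
    where
    square : ∀ D → + 0 * + 0 + D * (+ 1 * + 1) ≡ D
    square = solve-∀

  conj : ℤ × ℤ → ℤ × ℤ
  conj (a , b) = a , - b

  ⊗-conj : ∀ x → x ⊗ conj x ≈ₖ ι (norm x)
  ⊗-conj (a , b) = ℤₚ.reflexive (first D a b) , ℤₚ.reflexive (second a b)
    where
    first : ∀ D a b → a * a + D * (b * - b) ≡ a * a - D * (b * b)
    first = solve-∀
    second : ∀ a b → a * - b + b * a ≡ + 0
    second = solve-∀

  u²-D≉0 : ∀ u → ¬ u * u - D ≈ₚ + 0
  u²-D≉0 u u²-D≈0 = D-nonsquare u (unmod (x∙y⁻¹≈ε⇒x≈y (u * u) D u²-D≈0))

  [u²-D]⁻¹ : ℤ → ℤ
  [u²-D]⁻¹ u = proj₁ (inverse (u²-D≉0 u))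

  [u²-D][u²-D]⁻¹≈1 : ∀ u → (u * u - D) * [u²-D]⁻¹ u ≈ₚ + 1
  [u²-D][u²-D]⁻¹≈1 u = proj₂ (inverse (u²-D≉0 u))

  -- The Cayley parametrisation u ↦ (u + √D) / (u - √D) of the elements of norm 1 other than 1.
  cayley : ℤ → ℤ × ℤ
  cayley u = (u * u + D) * [u²-D]⁻¹ u , + 2 * u * [u²-D]⁻¹ u

  cayley-spec : ∀ u → cayley u ⊗ (u , - + 1) ≈ₖ (u , + 1)
  cayley-spec u =
    ℤₚ.trans (ℤₚ.reflexive (first D u t)) (ℤₚ.trans (ℤₚ.*-congˡ {u} ([u²-D][u²-D]⁻¹≈1 u)) (ℤₚ.reflexive (ℤ.*-identityʳ u))) ,
    ℤₚ.trans (ℤₚ.reflexive (second D u t)) ([u²-D][u²-D]⁻¹≈1 u)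
    where
    t : ℤ
    t = [u²-D]⁻¹ u
    first : ∀ D u t → (u * u + D) * t * u + D * (+ 2 * u * t * - + 1) ≡ u * ((u * u - D) * t)
    first = solve-∀
    second : ∀ D u t → (u * u + D) * t * - + 1 + + 2 * u * t * u ≡ (u * u - D) * t
    second = solve-∀

  norm-cayley : ∀ u → norm (cayley u) ≈ₚ + 1
  norm-cayley u = ℤₚ.trans (ℤₚ.reflexive (square D u t))
    (ℤₚ.*-cong ([u²-D][u²-D]⁻¹≈1 u) ([u²-D][u²-D]⁻¹≈1 u))
    where
    t : ℤ
    t = [u²-D]⁻¹ u
    square : ∀ D u t → (u * u + D) * t * ((u * u + D) * t) - D * (+ 2 * u * t * (+ 2 * u * t))
                     ≡ (u * u - D) * t * ((u * u - D) * t)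
    square = solve-∀

  H : List (ℤ × ℤ)
  H = 1ₖ ∷ applyUpTo (cayley ∘ +_) p

  length-H : length H ≡ suc p
  length-H = ≡.cong suc (List.length-applyUpTo (cayley ∘ +_) p)

  ∈H⇒norm≈1 : ∀ {x} → x ∈ H → norm x ≈ₚ + 1
  ∈H⇒norm≈1 (here x≈1)  = ℤₚ.trans (norm-cong x≈1) (ℤₚ.reflexive norm-1)
  ∈H⇒norm≈1 (there x∈H) = let i , _ , x≈cayley = Any.applyUpTo⁻ (cayley ∘ +_) x∈H in
    ℤₚ.trans (norm-cong x≈cayley) (norm-cayley (+ i))

  ∈H⇒≉0 : ∀ {x} → x ∈ H → ¬ x ≈ₖ 0ₖ
  ∈H⇒≉0 x∈H x≈0 = 1≉ₚ0 (ℤₚ.trans (ℤₚ.sym (∈H⇒norm≈1 x∈H)) (ℤₚ.trans (norm-cong x≈0) (ℤₚ.reflexive norm-0)))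

  2≉ₚ0 : ¬ + 2 ≈ₚ + 0
  2≉ₚ0 2≈0 = p≢2 (ℕ.≤-antisym (ℕ.∣⇒≤ (≈ₚ0⇒∣ 2≈0)) (ℕ.nonTrivial⇒n>1 p ⦃ prime⇒nonTrivial p-prime ⦄))

  cayley≉1 : ∀ u → ¬ 1ₖ ≈ₖ cayley u
  cayley≉1 u 1≈cayley = 2≉ₚ0 (mod (unmod (ℤₚ.sym (proj₂ (begin
    (u , - + 1)             ≈⟨ K.*-identityˡ _ ⟨
    1ₖ ⊗ (u , - + 1)        ≈⟨ K.*-congʳ 1≈cayley ⟩
    cayley u ⊗ (u , - + 1)  ≈⟨ cayley-spec u ⟩
    (u , + 1)               ∎)))))
    where open import Relation.Binary.Reasoning.Setoid K.setoid

  cayley-injective : ∀ {u v} → cayley u ≈ₖ cayley v → u ≈ₚ v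
  cayley-injective {u} {v} cayleyᵤ≈cayleyᵥ =
    [ (λ 2≈0 → contradiction 2≈0 2≉ₚ0) , x∙y⁻¹≈ε⇒x≈y u v ]′ (ℤₚ-zero-divisor (+ 2) (u - v) (ℤₚ.trans
      (ℤₚ.reflexive (twice u v))
      (ℤₚ.trans (ℤₚ.+-congʳ (ℤₚ.sym (proj₂ swapped))) (ℤₚ.-‿inverseʳ (u * - + 1 + + 1 * v)))))
    where
    open import Relation.Binary.Reasoning.Setoid K.setoid
    wᵤ wᵥ : ℤ × ℤ
    wᵤ = u , - + 1
    wᵥ = v , - + 1
    swapped : (u , + 1) ⊗ wᵥ ≈ₖ (v , + 1) ⊗ wᵤ
    swapped = begin
      (u , + 1) ⊗ wᵥ          ≈⟨ K.*-congʳ {wᵥ} (cayley-spec u) ⟨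
      cayley u ⊗ wᵤ ⊗ wᵥ      ≈⟨ K.*-congʳ {wᵥ} (K.*-congʳ {wᵤ} cayleyᵤ≈cayleyᵥ) ⟩
      cayley v ⊗ wᵤ ⊗ wᵥ      ≈⟨ K.*-assoc (cayley v) wᵤ wᵥ ⟩
      cayley v ⊗ (wᵤ ⊗ wᵥ)    ≈⟨ K.*-congˡ {cayley v} (K.*-comm wᵤ wᵥ) ⟩
      cayley v ⊗ (wᵥ ⊗ wᵤ)    ≈⟨ K.*-assoc (cayley v) wᵥ wᵤ ⟨
      cayley v ⊗ wᵥ ⊗ wᵤ      ≈⟨ K.*-congʳ {wᵤ} (cayley-spec v) ⟩
      (v , + 1) ⊗ wᵤ          ∎
    twice : ∀ u v → + 2 * (u - v) ≡ (v * - + 1 + + 1 * u) - (u * - + 1 + + 1 * v)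
    twice = solve-∀

  ≈cayley⇒∈H : ∀ {x} k → k ℕ.< p → x ≈ₖ cayley (+ k) → x ∈ H
  ≈cayley⇒∈H {x} k k<p x≈cayley = there (Any.applyUpTo⁺ {P = x ≈ₖ_} (cayley ∘ +_) {i = k} {n = p} x≈cayley k<p)

  norm≈1∧b≈0⇒∈H : ∀ {a b} → norm (a , b) ≈ₚ + 1 → b ≈ₚ + 0 → (a , b) ∈ H
  norm≈1∧b≈0⇒∈H {a} {b} norm≈1 b≈0 = [ (λ a-1≈0 → here (x∙y⁻¹≈ε⇒x≈y a (+ 1) a-1≈0 , b≈0))
                  , (λ a+1≈0 → ≈cayley⇒∈H 0 (ℕ.>-nonZero⁻¹ p ⦃ prime⇒nonZero p-prime ⦄) (a≈-1 a+1≈0 , b≈0))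
                  ]′ (ℤₚ-zero-divisor (a - + 1) (a + + 1) (begin
      (a - + 1) * (a + + 1)          ≡⟨ difference-of-squares a ⟩
      a * a - + 1                    ≈⟨ ℤₚ.+-congʳ a²≈1 ⟩
      + 1 - + 1                      ∎))
    where
    open import Relation.Binary.Reasoning.Setoid (CommutativeRing.setoid ℤₚ)
    difference-of-squares : ∀ a → (a - + 1) * (a + + 1) ≡ a * a - + 1
    difference-of-squares = solve-∀
    add-sub : ∀ a e → a * a ≡ (a * a - e) + e
    add-sub = solve-∀
    add-sub-1 : ∀ a → a ≡ (a + + 1) - + 1
    add-sub-1 = solve-∀
    a²≈1 : a * a ≈ₚ + 1
    a²≈1 = begin
      a * a                          ≡⟨ add-sub a (D * (b * b)) ⟩
      (a * a - D * (b * b)) + D * (b * b)  ≈⟨ ℤₚ.+-cong norm≈1 (ℤₚ.*-congˡ {D} (ℤₚ.*-cong b≈0 b≈0)) ⟩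
      + 1 + D * (+ 0 * + 0)          ≡⟨ ≡.cong (λ t → + 1 + t) (ℤ.*-zeroʳ D) ⟩
      + 1                            ∎
    t : ℤ
    t = [u²-D]⁻¹ (+ 0)
    a≈-1 : a + + 1 ≈ₚ + 0 → a ≈ₚ (+ 0 * + 0 + D) * t
    a≈-1 a+1≈0 = begin
      a                              ≡⟨ add-sub-1 a ⟩
      (a + + 1) - + 1                ≈⟨ ℤₚ.+-congʳ a+1≈0 ⟩
      - + 1                          ≈⟨ ℤₚ.-‿cong ([u²-D][u²-D]⁻¹≈1 (+ 0)) ⟨
      - ((+ 0 * + 0 - D) * t)        ≡⟨ negate D t ⟩
      (+ 0 * + 0 + D) * t            ∎
      where
      negate : ∀ D t → - ((+ 0 * + 0 - D) * t) ≡ (+ 0 * + 0 + D) * t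
      negate = solve-∀

  norm≈1∧b≉0⇒∈H : ∀ {a b} → norm (a , b) ≈ₚ + 1 → ¬ b ≈ₚ + 0 → (a , b) ∈ H
  norm≈1∧b≉0⇒∈H {a} {b} norm≈1 b≉0 = ≈cayley⇒∈H k k<p x≈cayley
    where
    b⁻¹ : ℤ
    b⁻¹ = proj₁ (inverse b≉0)
    bb⁻¹≈1 : b * b⁻¹ ≈ₚ + 1
    bb⁻¹≈1 = proj₂ (inverse b≉0)
    -- (a , b) is the Cayley image of u = (a + 1)/b, represented by a residue k < p.
    k : ℕ
    k = proj₁ (residue ((a + + 1) * b⁻¹))
    k<p : k ℕ.< p
    k<p = proj₁ (proj₂ (residue ((a + + 1) * b⁻¹)))
    u≈k : (a + + 1) * b⁻¹ ≈ₚ + k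
    u≈k = proj₂ (proj₂ (residue ((a + + 1) * b⁻¹)))

    kb≈a+1 : + k * b ≈ₚ a + + 1
    kb≈a+1 = begin
      + k * b                        ≈⟨ ℤₚ.*-congʳ u≈k ⟨
      (a + + 1) * b⁻¹ * b            ≡⟨ regroup′ (a + + 1) b⁻¹ b ⟩
      (a + + 1) * (b * b⁻¹)          ≈⟨ ℤₚ.*-congˡ {a + + 1} bb⁻¹≈1 ⟩
      (a + + 1) * + 1                ≡⟨ ℤ.*-identityʳ (a + + 1) ⟩
      a + + 1                        ∎
      where
      open import Relation.Binary.Reasoning.Setoid (CommutativeRing.setoid ℤₚ)
      regroup′ : ∀ c i b → c * i * b ≡ c * (b * i)
      regroup′ = solve-∀

    first : a * + k + D * (b * - + 1) ≈ₚ + k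
    first = ℤₚ-Domain.*-cancelʳ b≉0 (begin
      (a * + k + D * (b * - + 1)) * b  ≡⟨ expand₁ a (+ k) D b ⟩
      a * (+ k * b) - D * (b * b)      ≈⟨ ℤₚ.+-congʳ (ℤₚ.*-congˡ {a} kb≈a+1) ⟩
      a * (a + + 1) - D * (b * b)      ≡⟨ expand₂ a D b ⟩
      (a * a - D * (b * b)) + a        ≈⟨ ℤₚ.+-congʳ norm≈1 ⟩
      + 1 + a                          ≈⟨ ℤₚ.+-comm (+ 1) a ⟩
      a + + 1                          ≈⟨ kb≈a+1 ⟨
      + k * b                          ∎)
      where
      open import Relation.Binary.Reasoning.Setoid (CommutativeRing.setoid ℤₚ)
      expand₁ : ∀ a k D b → (a * k + D * (b * - + 1)) * b ≡ a * (k * b) - D * (b * b)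
      expand₁ = solve-∀
      expand₂ : ∀ a D b → a * (a + + 1) - D * (b * b) ≡ (a * a - D * (b * b)) + a
      expand₂ = solve-∀

    second : a * - + 1 + b * + k ≈ₚ + 1
    second = begin
      a * - + 1 + b * + k              ≈⟨ ℤₚ.+-congˡ {a * - + 1} (ℤₚ.trans (ℤₚ.*-comm b (+ k)) kb≈a+1) ⟩
      a * - + 1 + (a + + 1)            ≡⟨ cancel a ⟩
      + 1                              ∎
      where
      open import Relation.Binary.Reasoning.Setoid (CommutativeRing.setoid ℤₚ)
      cancel : ∀ a → a * - + 1 + (a + + 1) ≡ + 1
      cancel = solve-∀

    x≈cayley : (a , b) ≈ₖ cayley (+ k)
    x≈cayley = *-cancelʳ (λ (_ , -1≈0) → 1≉ₚ0 (ℤₚ.-‿cong -1≈0))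
      (K.trans (first , second) (K.sym (cayley-spec (+ k))))

  norm≈1⇒∈H : ∀ {x} → norm x ≈ₚ + 1 → x ∈ H
  norm≈1⇒∈H {a , b} norm≈1 = case b ≟ₚ + 0 of λ where
    (yes b≈0) → norm≈1∧b≈0⇒∈H norm≈1 b≈0
    (no  b≉0) → norm≈1∧b≉0⇒∈H norm≈1 b≉0

  H! : Unique H
  H! = All.applyUpTo⁺₁ {P = λ y → ¬ 1ₖ ≈ₖ y} (cayley ∘ +_) p (λ {i} _ → cayley≉1 (+ i))
     ∷ AllPairs.applyUpTo⁺₁ {R = λ y z → ¬ y ≈ₖ z} (cayley ∘ +_) p (λ {i} {j} i<j j<p cayleyᵢ≈cayleyⱼ →
         ℕ.<-irrefl (residue-injective (ℕ.<-trans i<j j<p) j<p (cayley-injective {+ i} {+ j} cayleyᵢ≈cayleyⱼ)) i<j)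

  ∈H-closed : ∀ {x y} → x ∈ H → y ∈ H → x ⊗ y ∈ H
  ∈H-closed {x} {y} x∈H y∈H = norm≈1⇒∈H (ℤₚ.trans (ℤₚ.reflexive (norm-⊗ x y))
    (ℤₚ.trans (ℤₚ.*-cong (∈H⇒norm≈1 x∈H) (∈H⇒norm≈1 y∈H)) ℤₚ.refl))

  norm-one⇒∈H : ∀ x y → (ι x ⊕ √D ⊗ ι y) ⊗ (ι x ⊕ ⊖ (√D ⊗ ι y)) ≈ₖ 1ₖ → ι x ⊕ √D ⊗ ι y ∈ H
  norm-one⇒∈H x y norm≈1 = ∈-resp-≈ K.setoid (K.sym z≈xy)
    (norm≈1⇒∈H (proj₁ (begin
      ι (norm (x , y))                                 ≈⟨ ⊗-conj (x , y) ⟨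
      (x , y) ⊗ conj (x , y)                           ≈⟨ K.*-cong z≈xy z̄≈conj ⟨
      (ι x ⊕ √D ⊗ ι y) ⊗ (ι x ⊕ ⊖ (√D ⊗ ι y))          ≈⟨ norm≈1 ⟩
      1ₖ                                               ∎)))
    where
    open import Relation.Binary.Reasoning.Setoid K.setoid
    first : ∀ D x y → x + (+ 0 * y + D * (+ 1 * + 0)) ≡ x
    first = solve-∀
    second : ∀ y → + 0 + (+ 0 * + 0 + + 1 * y) ≡ y
    second = solve-∀
    z≈xy : ι x ⊕ √D ⊗ ι y ≈ₖ (x , y)
    z≈xy = ℤₚ.reflexive (first D x y) , ℤₚ.reflexive (second y)
    first′ : ∀ D x y → x + - (+ 0 * y + D * (+ 1 * + 0)) ≡ x
    first′ = solve-∀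
    second′ : ∀ y → + 0 + - (+ 0 * + 0 + + 1 * y) ≡ - y
    second′ = solve-∀
    z̄≈conj : ι x ⊕ ⊖ (√D ⊗ ι y) ≈ₖ conj (x , y)
    z̄≈conj = ℤₚ.reflexive (first′ D x y) , ℤₚ.reflexive (second′ y)

  ∈H⇒trace : ∀ {z w} → z ∈ H → z ⊗ w ≈ₖ 1ₖ → ∃[ X ] ι X ≈ₖ z ⊕ w
  ∈H⇒trace {a , b} {w} z∈H zw≈1 = a + a , (begin
    ι (a + a)                ≈⟨ ℤₚ.refl , ℤₚ.reflexive (≡.sym (ℤ.+-inverseʳ b)) ⟩
    (a , b) ⊕ conj (a , b)   ≈⟨ K.+-congˡ {a , b} (K.sym w≈conj) ⟩
    (a , b) ⊕ w              ∎)
    where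
    open import Relation.Binary.Reasoning.Setoid K.setoid
    w≈conj : w ≈ₖ conj (a , b)
    w≈conj = inverse-unique {a , b} zw≈1 (K.trans (⊗-conj (a , b)) (∈H⇒norm≈1 {a , b} z∈H , ℤₚ.refl))

module SplitCase
  (p : ℕ) (p-prime : Prime p) (P Q Q* : ℤ)
  (p∤2PQD : ¬ (+ p ℤᵤ.∣ + 2 ℤ.* P ℤ.* Q ℤ.* disc P Q)) (QQ*≡1 : (Q ℤ.* Q*) ≡ + 1 [mod p ])
  (d : ℕ) (d²≡D : (+ d ℤ.* + d) ≡ disc P Q [mod p ])
  where

  open Modular p p-prime
  open Lucas ℤₚ ℤₚ-ι _≟ₚ_ 1≉ₚ0 ℤₚ-zero-divisor p p-prime (∣⇒≈ₚ0 ℕ.∣-refl)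
  open Criterion P Q Q* p∤2PQD (mod QQ*≡1) (+ d) (mod d²≡D) units units! units-closed (≉0⇒∈units 1≉ₚ0)
    ∈units⇒≉0 (λ x y norm≈1 → ≉0⇒∈units (ℤₚ-Domain.unit≉0 norm≈1)) (λ {z} {w} _ _ → z ℤ.+ w , CommutativeRing.refl ℤₚ)

  theorem : legendre (disc P Q) p ≡ + 1 → (m : ℕ) → 0 ℕ.< m → m ℕ.∣ pMinusLeg P Q p →
    (r : ℕ) → IsRestrictedPeriod P Q p r →
    (m ℕ.∣ sOf P Q p r) ⇔ ∃ (λ (X : ℤ) → V X (+ 1) m ≡ P ℤ.* P ℤ.* Q* ℤ.- + 2 [mod p ])
  theorem legendre≡1 = divides-s⇔V-solvable (≡.trans length-units (≡.trans (pred≡ p ⦃ prime⇒nonZero p-prime ⦄)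
    (≡.cong (λ l → ℤ.∣ + p ℤ.- l ∣) (≡.sym legendre≡1))))
    where
    pred≡ : ∀ n → .⦃ _ : ℕ.NonZero n ⦄ → ℕ.pred n ≡ ℤ.∣ + n ℤ.- + 1 ∣
    pred≡ (ℕ.suc n) = ≡.refl

module NonsplitCase
  (p : ℕ) (p-prime : Prime p) (p≢2 : p ≢ 2) (P Q Q* : ℤ)
  (p∤2PQD : ¬ (+ p ℤᵤ.∣ + 2 ℤ.* P ℤ.* Q ℤ.* disc P Q)) (QQ*≡1 : (Q ℤ.* Q*) ≡ + 1 [mod p ])
  (no-root : ∀ x → x ℕ.< p → ¬ (+ x ℤ.* + x) ≡ disc P Q [mod p ])
  where

  open Modular p p-prime

  D-nonsquare : ∀ y → ¬ (y ℤ.* y) ≡ disc P Q [mod p ]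
  D-nonsquare y y²≡D = let k , k<p , y≈k = residue y in
    no-root k k<p (unmod (ℤₚ.trans (ℤₚ.*-cong (ℤₚ.sym y≈k) (ℤₚ.sym y≈k)) (mod y²≡D)))
    where module ℤₚ = CommutativeRing ℤₚ

  open QuadraticExtension p p-prime p≢2 (disc P Q) D-nonsquare
  open ℤₚ[√D]-Lucas.Criterion P Q Q* p∤2PQD (mod QQ*≡1) √D √D²≈D H H! ∈H-closed
    (here (CommutativeRing.refl ℤₚ[√D])) ∈H⇒≉0 norm-one⇒∈H ∈H⇒trace

  theorem : legendre (disc P Q) p ≡ -[1+ 0 ] → (m : ℕ) → 0 ℕ.< m → m ℕ.∣ pMinusLeg P Q p →
    (r : ℕ) → IsRestrictedPeriod P Q p r →
    (m ℕ.∣ sOf P Q p r) ⇔ ∃ (λ (X : ℤ) → V X (+ 1) m ≡ P ℤ.* P ℤ.* Q* ℤ.- + 2 [mod p ])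
  theorem legendre≡-1 = divides-s⇔V-solvable (≡.trans length-H (≡.trans (ℕ.+-comm 1 p)
    (≡.cong (λ l → ℤ.∣ + p ℤ.- l ∣) (≡.sym legendre≡-1))))

data LegendreView (a : ℤ) (p : ℕ) : ℤ → Set where
  divisible : p ℕ.∣ ℤ.∣ a ∣ → LegendreView a p (+ 0)
  square    : ∀ x → (+ x ℤ.* + x) ≡ a [mod p ] → LegendreView a p (+ 1)
  nonsquare : (∀ x → x ℕ.< p → ¬ (+ x ℤ.* + x) ≡ a [mod p ]) → LegendreView a p -[1+ 0 ]

legendre-view : ∀ a p → LegendreView a p (legendre a p)
legendre-view a p with p ℕ.∣? ℤ.∣ a ∣
... | yes p∣a = divisible p∣a
... | no _ with any? (λ x → p ℕ.∣? ℤ.∣ + x ℤ.* + x ℤ.- a ∣) (upTo p)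
...   | yes found = let x , _ , x²≡a = Membership.find found in square x x²≡a
...   | no  none  = nonsquare (λ x x<p x²≡a → none (Membership.lose (∈-upTo⁺ x<p) x²≡a))

theorem1p4 : (P Q : ℤ) (p : ℕ) → Prime p → p ≢ 2 →
    ¬ ((+ p) ℤᵤ.∣ (+ 2 ℤ.* P ℤ.* Q ℤ.* disc P Q)) →
    (m : ℕ) → 0 ℕ.< m → m ℕ.∣ pMinusLeg P Q p →
    (r : ℕ) → IsRestrictedPeriod P Q p r →
    (Qs : ℤ) → (Q ℤ.* Qs) ≡ + 1 [mod p ] →
    (m ℕ.∣ sOf P Q p r) ⇔ ∃ (λ (X : ℤ) → V X (+ 1) m ≡ P ℤ.* P ℤ.* Qs ℤ.- + 2 [mod p ])
theorem1p4 P Q p p-prime p≢2 p∤2PQD m 0<m m∣N r r-period Q* QQ*≡1 =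
  by-cases (legendre-view (disc P Q) p) ≡.refl
  where
  by-cases : ∀ {ℓ} → LegendreView (disc P Q) p ℓ → legendre (disc P Q) p ≡ ℓ →
             (m ℕ.∣ sOf P Q p r) ⇔ ∃ (λ X → V X (+ 1) m ≡ P ℤ.* P ℤ.* Q* ℤ.- + 2 [mod p ])
  by-cases (divisible p∣D) _ =
    contradiction (ℤₛ.∣⇒∣ᵤ {+ p} (ℤₛ.∣n⇒∣m*n (+ 2 ℤ.* P ℤ.* Q) (ℤₛ.∣ᵤ⇒∣ {+ p} p∣D))) p∤2PQD
  by-cases (square d d²≡D) legendre≡1 =
    SplitCase.theorem p p-prime P Q Q* p∤2PQD QQ*≡1 d d²≡D legendre≡1 m 0<m m∣N r r-period
  by-cases (nonsquare no-root) legendre≡-1 =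
    NonsplitCase.theorem p p-prime p≢2 P Q Q* p∤2PQD QQ*≡1 no-root legendre≡-1 m 0<m m∣N r r-period
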